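{- Let $q$ be a power of a prime $p$, let $d$ be a divisor of $q-1$ with $d>1$, and let $S_d=\{x^d:x\in\mathbb{F}_q^*\}$. Suppose $A,B\subset\mathbb{F}_q$ satisfy $A+B=S_d$ with $|A|,|B|\ge2$. Then exactly one of the following holds: (1) $|A||B|=|S_d|$, that is, all sums $a+b$ ($a\in A,b\in B$) are distinct; (2) $|A||B|>|S_d|$. In this case $$\binom{|A|-1+\frac{q-1}{d}}{\frac{q-1}{d}}\equiv0\pmod p,\qquad \binom{|B|-1+\frac{q-1}{d}}{\frac{q-1}{d}}\equiv0\pmod p.$$ Moreover, writing $A=\{a_1,\dots,a_n\}$ and $B=\{b_1,\dots,b_m\}$ (distinct elements), and letting $c_1,\dots,c_n\in\mathbb{F}_q$ and $d_1,\dots,d_m\in\mathbb{F}_q$ be the unique solutions of $$\sum_{i=1}^n c_ia_i^j=0\ (0\le j\le n-2),\quad \sum_{i=1}^n c_ia_i^{n-1}=1,\qquad \sum_{k=1}^m d_kb_k^\ell=0\ (0\le\ell\le m-2),\quad \sum_{k=1}^m d_kb_k^{m-1}=1,$$ one has $$\binom{n-1+\frac{q-1}{d}}{j}\sum_{i=1}^n c_ia_i^j=0\ \text{ for all }0\le j<n-1+\tfrac{q-1}{d},\qquad \binom{m-1+\frac{q-1}{d}}{\ell}\sum_{k=1}^m d_kb_k^\ell=0\ \text{ for all }0\le\ell<m-1+\tfrac{q-1}{d},$$ and $$\sum_{i=1}^n c_ia_i^{n-1+\frac{q-1}{d}}=1,\qquad \sum_{k=1}^m d_kb_k^{m-1+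\frac{q-1}{d}}=1.$$
   Context: $\mathbb{F}_q$ is the finite field with $q$ elements, of characteristic $p$. $A+B=\{a+b:a\in A,b\in B\}$. Binomial coefficients are integers, viewed in $\mathbb{F}_q$ via reduction mod $p$. -}

module Defs where

open import Level using (0ℓ)
open import Data.Nat as ℕ using (ℕ; zero; suc)
open import Data.Fin as Fin using (Fin)
open import Data.Fin.Properties as FinP using ()
open import Data.List using (List; map; filter; length)
open import Data.List.Relation.Unary.Any using (any?)
open import Data.Product using (Σ; ∃; _×_; _,_)
open import Relation.Nullary using (¬_; Dec; yes; no)
open import Relation.Nullary.Decidable using (map′; ¬?; _×-dec_)
open import Relation.Binary.PropositionalEquality using (_≡_; refl; cong; sym; trans)
open import Algebra.Structures using (IsCommutativeRing)
open import Function.Bundles using (_↔_; Inverse)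
open import Data.List.Base using () renaming (allFin to allFinL)

record FiniteField (q : ℕ) : Set₁ where
  infixl 6 _+_
  infixl 7 _*_
  field
    F     : Set
    _+_   : F → F → F
    _*_   : F → F → F
    -_    : F → F
    0#    : F
    1#    : F
    isCommutativeRing : IsCommutativeRing _≡_ _+_ _*_ -_ 0# 1#
    0≢1   : ¬ (0# ≡ 1#)
    inverse : ∀ x → ¬ (x ≡ 0#) → Σ F (λ y → x * y ≡ 1#)
    enum  : F ↔ Fin q

  _^_ : F → ℕ → F
  x ^ zero  = 1#
  x ^ suc k = x * (x ^ k)

  fromℕ : ℕ → F
  fromℕ zero    = 0#
  fromℕ (suc k) = 1# + fromℕ k

  sum : ∀ {n} → (Fin n → F) → F
  sum {zero}  f = 0#
  sum {suc n} f = f Fin.zero + sum (λ i → f (Fin.suc i))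

  _≟_ : (x y : F) → Dec (x ≡ y)
  x ≟ y = map′ to-inj (cong (Inverse.to enum)) (Inverse.to enum x FinP.≟ Inverse.to enum y)
    where
    to-inj : Inverse.to enum x ≡ Inverse.to enum y → x ≡ y
    to-inj e = trans (sym (Inverse.strictlyInverseʳ enum x))
                 (trans (cong (Inverse.from enum) e) (Inverse.strictlyInverseʳ enum y))

  elements : List F
  elements = map (Inverse.from enum) (allFinL q)

  InS : ℕ → F → Set
  InS d y = ∃ λ x → ¬ (x ≡ 0#) × (x ^ d ≡ y)

  InS? : (d : ℕ) (y : F) → Dec (InS d y)
  InS? d y = map′ from to (any? (λ x → ¬? (x ≟ 0#) ×-dec ((x ^ d) ≟ y)) elements)
    where
    open import Data.List.Relation.Unary.Any using (Any)
    open import Data.List.Membership.Propositional.Properties using (∈-map⁺; ∈-allFin)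
    open import Data.List.Relation.Unary.Any.Properties using (lookup-result)
    open import Data.List.Relation.Unary.Any using (lookup; satisfied)
    open import Data.List.Membership.Propositional using (_∈_)
    open import Data.List.Relation.Unary.Any.Properties using (map⁺)
    from : Any (λ x → ¬ (x ≡ 0#) × (x ^ d ≡ y)) elements → InS d y
    from p = satisfied p
    to : InS d y → Any (λ x → ¬ (x ≡ 0#) × (x ^ d ≡ y)) elements
    to (x , h) = Data.List.Relation.Unary.Any.map (λ { refl → h }) mem
      where
      import Data.List.Relation.Unary.Any
      open import Relation.Binary.PropositionalEquality using (subst)
      mem : x ∈ elements
      mem = subst (_∈ elements) (Inverse.strictlyInverseʳ enum x)
              (∈-map⁺ (Inverse.from enum) (∈-allFin (Inverse.to enum x)))

  cardS : ℕ → ℕ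
  cardS d = length (filter (InS? d) elements)

module Submission where

-- Counting gives |S_d| ≤ |A||B|, with equality exactly when the sums are distinct, and
-- |S_d| ≥ e = (q−1)/d since x ↦ x^d has fibres of size at most d. Otherwise |A||B| > e, and the
-- polynomial method applies: every a + b is an e-th root of unity, so for the dual Vandermonde vector
-- c of A the polynomial ∑ᵢ cᵢ (x + aᵢ)^(n−1+e) − 1 has degree at most e (its higher coefficients are
-- vanishing moments of c) yet, by Hasse derivatives, vanishes to order n at each of the m points of B.
-- Hence it is zero; its j-th coefficient is C(n−1+e, j) ∑ᵢ cᵢ aᵢ^(n−1+e−j) − [j = 0], which gives the
-- moment identities and, at j = e, the divisibility of C(n−1+e, e) by the characteristic p.

open import Defs
open import Level using (0ℓ)
open import Algebra.Bundles using (CommutativeRing)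
open import Algebra.Structures using (IsCommutativeRing)
open import Data.Empty using (⊥; ⊥-elim)
open import Data.Fin as Fin using (Fin)
import Data.Fin.Properties as Fin
import Data.Fin.Permutation as Perm
open import Data.List as List using (List; []; _∷_)
import Data.List.Properties as List
open import Data.List.Membership.Propositional using (_∈_)
open import Data.List.Membership.Propositional.Properties using (∈-map⁺; ∈-allFin; ∈-filter⁺; ∈-cartesianProduct⁺)
import Data.List.Relation.Binary.Sublist.Propositional.Properties as Sublist
open import Data.List.Relation.Unary.All as All using (All; []; _∷_)
import Data.List.Relation.Unary.All.Properties as All
open import Data.List.Relation.Unary.AllPairs as AllPairs using (AllPairs; []; _∷_)
import Data.List.Relation.Unary.AllPairs.Properties as AllPairs
open import Data.List.Relation.Unary.Any as Any using (Any; here; there)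
open import Data.List.Relation.Unary.Unique.Propositional using (Unique)
import Data.List.Relation.Unary.Unique.Propositional.Properties as Unique
open import Data.Nat as ℕ using (ℕ; zero; suc; _∸_; _<_; _≤_; z≤n; s≤s)
import Data.Nat.Properties as ℕP
import Data.Nat.ListAction as ℕᴸ
open import Data.Nat.Combinatorics using (_C_; nCk≡nC[n∸k]; nCn≡1; nCk+nC[k+1]≡[n+1]C[k+1])
open import Data.Nat.Combinatorics.Specification using (k>n⇒nCk≡0)
open import Data.Nat.Coprimality using (prime⇒coprime; coprime-Bézout)
open import Data.Nat.Divisibility using (_∣_; quotient; m%n≡0⇒n∣m)
open import Data.Nat.DivMod using (_%_; _/_; m≡m%n+[m/n]*n; m%n<n)
open import Data.Nat.GCD using (module Bézout)
open import Data.Nat.Primality using (Prime; prime⇒nonZero)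
open import Data.Product using (∃; ∃₂; _×_; _,_; proj₁; proj₂; Σ)
open import Data.Product.Properties using () renaming (≡-dec to ×-≡-dec)
open import Data.Sum using (_⊎_; inj₁; inj₂; [_,_]′)
open import Function.Bundles using (_⇔_; Equivalence; Inverse; Injection)
open import Function.Definitions using (Injective)
open import Function.Properties.Inverse using (↔⇒↣)
open import Relation.Binary.Definitions using (DecidableEquality)
open import Relation.Binary.PropositionalEquality
open import Relation.Nullary using (¬_; Dec; yes; no; ¬?)
open import Relation.Unary using (Decidable; _≐_)
open import Function.Base using (_∘_)

length-cartesianProduct : ∀ {A B : Set} (xs : List A) (ys : List B) →
  List.length (List.cartesianProduct xs ys) ≡ List.length xs ℕ.* List.length ys
length-cartesianProduct []       ys = refl
length-cartesianProduct (x ∷ xs) ys = trans (List.length-++ (List.map (x ,_) ys))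
  (cong₂ ℕ._+_ (List.length-map (x ,_) ys) (length-cartesianProduct xs ys))

AllPairs-injective : ∀ {A B : Set} (f : A → B) → DecidableEquality A → ∀ {xs} → (∀ x → x ∈ xs) →
  AllPairs (λ u v → ¬ (f u ≡ f v)) xs → Injective _≡_ _≡_ f
AllPairs-injective f _≟ᴬ_ complete distinct {u} {v} fu≡fv with u ≟ᴬ v
... | yes u≡v = u≡v
... | no  u≢v = ⊥-elim (separated distinct (complete u) (complete v) u≢v)
  where
  separated : ∀ {xs} → AllPairs (λ u v → ¬ (f u ≡ f v)) xs → u ∈ xs → v ∈ xs → ¬ (u ≡ v) → ⊥
  separated (_ ∷ _)        (here refl) (here refl) u≢v = u≢v refl
  separated (u∉ ∷ _)       (here refl) (there v∈)  _   = All.lookup u∉ v∈ fu≡fv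
  separated (v∉ ∷ _)       (there u∈)  (here refl) _   = All.lookup v∉ u∈ (sym fu≡fv)
  separated (_ ∷ distinct) (there u∈)  (there v∈)  u≢v = separated distinct u∈ v∈ u≢v

module FieldProperties {q : ℕ} (𝔽 : FiniteField q) where
  open FiniteField 𝔽
  open IsCommutativeRing isCommutativeRing public
    using (+-assoc; +-comm; +-identityˡ; +-identityʳ; -‿inverseˡ; -‿inverseʳ;
           *-assoc; *-comm; *-identityˡ; *-identityʳ; distribˡ; distribʳ; zeroˡ; zeroʳ)

  commutativeRing : CommutativeRing 0ℓ 0ℓ
  commutativeRing = record { isCommutativeRing = isCommutativeRing }

  open CommutativeRing commutativeRing using (commutativeSemiring; ring; +-abelianGroup)
  open import Algebra.Solver.Ring.NaturalCoefficients.Default commutativeSemiring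
  open import Algebra.Properties.Ring ring using (-‿distribˡ-*; -‿involutive)
  open import Algebra.Properties.AbelianGroup +-abelianGroup using (inverseˡ-unique; ⁻¹-∙-comm)
  open ≡-Reasoning

  x≢y⇒x-y≢0 : ∀ {x y} → ¬ (x ≡ y) → ¬ (x + - y ≡ 0#)
  x≢y⇒x-y≢0 {x} {y} x≢y x-y≡0 = x≢y (trans (inverseˡ-unique x (- y) x-y≡0) (-‿involutive y))

  x+y-y≡x : ∀ x y → x + y + - y ≡ x
  x+y-y≡x x y = trans (+-assoc x y (- y)) (trans (cong (x +_) (-‿inverseʳ y)) (+-identityʳ x))

  *-cancelˡ : ∀ {x} y z → ¬ (x ≡ 0#) → x * y ≡ x * z → y ≡ z
  *-cancelˡ {x} y z x≢0 xy≡xz = begin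
    y              ≡⟨ sym (*-identityˡ y) ⟩
    1# * y         ≡⟨ cong (_* y) (sym x⁻¹x≡1) ⟩
    (x⁻¹ * x) * y  ≡⟨ *-assoc x⁻¹ x y ⟩
    x⁻¹ * (x * y)  ≡⟨ cong (x⁻¹ *_) xy≡xz ⟩
    x⁻¹ * (x * z)  ≡⟨ sym (*-assoc x⁻¹ x z) ⟩
    (x⁻¹ * x) * z  ≡⟨ cong (_* z) x⁻¹x≡1 ⟩
    1# * z         ≡⟨ *-identityˡ z ⟩
    z              ∎
    where
    x⁻¹ = proj₁ (inverse x x≢0)
    x⁻¹x≡1 : x⁻¹ * x ≡ 1#
    x⁻¹x≡1 = trans (*-comm x⁻¹ x) (proj₂ (inverse x x≢0))

  x*y≡0⇒y≡0 : ∀ {x y} → ¬ (x ≡ 0#) → x * y ≡ 0# → y ≡ 0#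
  x*y≡0⇒y≡0 {x} {y} x≢0 xy≡0 = *-cancelˡ y 0# x≢0 (trans xy≡0 (sym (zeroʳ x)))

  x*y≢0 : ∀ {x y} → ¬ (x ≡ 0#) → ¬ (y ≡ 0#) → ¬ (x * y ≡ 0#)
  x*y≢0 x≢0 y≢0 xy≡0 = y≢0 (x*y≡0⇒y≡0 x≢0 xy≡0)

  ^-homo-* : ∀ x m n → x ^ (m ℕ.+ n) ≡ x ^ m * x ^ n
  ^-homo-* x zero    n = sym (*-identityˡ _)
  ^-homo-* x (suc m) n = trans (cong (x *_) (^-homo-* x m n)) (sym (*-assoc _ _ _))

  ^-assocʳ : ∀ x m n → (x ^ m) ^ n ≡ x ^ (m ℕ.* n)
  ^-assocʳ x m zero    = cong (x ^_) (sym (ℕP.*-zeroʳ m))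
  ^-assocʳ x m (suc n) = begin
    x ^ m * (x ^ m) ^ n    ≡⟨ cong (x ^ m *_) (^-assocʳ x m n) ⟩
    x ^ m * x ^ (m ℕ.* n)  ≡⟨ sym (^-homo-* x m (m ℕ.* n)) ⟩
    x ^ (m ℕ.+ m ℕ.* n)    ≡⟨ cong (x ^_) (sym (ℕP.*-suc m n)) ⟩
    x ^ (m ℕ.* suc n)      ∎

  fromℕ-homo-+ : ∀ m n → fromℕ (m ℕ.+ n) ≡ fromℕ m + fromℕ n
  fromℕ-homo-+ zero    n = sym (+-identityˡ _)
  fromℕ-homo-+ (suc m) n = trans (cong (1# +_) (fromℕ-homo-+ m n)) (sym (+-assoc _ _ _))

  fromℕ-homo-* : ∀ m n → fromℕ (m ℕ.* n) ≡ fromℕ m * fromℕ n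
  fromℕ-homo-* zero    n = sym (zeroˡ _)
  fromℕ-homo-* (suc m) n = begin
    fromℕ (n ℕ.+ m ℕ.* n)        ≡⟨ fromℕ-homo-+ n (m ℕ.* n) ⟩
    fromℕ n + fromℕ (m ℕ.* n)    ≡⟨ cong (fromℕ n +_) (fromℕ-homo-* m n) ⟩
    fromℕ n + fromℕ m * fromℕ n  ≡⟨ solve 2 (λ x y → y :+ x :* y := (con 1 :+ x) :* y) refl _ _ ⟩
    (1# + fromℕ m) * fromℕ n     ∎

  fromℕ-1 : fromℕ 1 ≡ 1#
  fromℕ-1 = +-identityʳ 1#

  fromℕ-pascal : ∀ n k → fromℕ (suc n C suc k) ≡ fromℕ (n C k) + fromℕ (n C suc k)
  fromℕ-pascal n k = trans (cong fromℕ (sym (nCk+nC[k+1]≡[n+1]C[k+1] n k))) (fromℕ-homo-+ (n C k) (n C suc k))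

  fromℕ-C-vanishes : ∀ {n k} → n < k → fromℕ (n C k) ≡ 0#
  fromℕ-C-vanishes n<k = cong fromℕ (k>n⇒nCk≡0 n<k)

  -- Finite sums

  ∑< : ℕ → (ℕ → F) → F
  ∑< zero    f = 0#
  ∑< (suc L) f = f 0 + ∑< L (λ j → f (suc j))

  infix 5 ∑<
  syntax ∑< L (λ j → e) = ∑[ j < L ] e

  ∑<-cong : ∀ L {f g : ℕ → F} → (∀ j → j < L → f j ≡ g j) → ∑< L f ≡ ∑< L g
  ∑<-cong zero    f≡g = refl
  ∑<-cong (suc L) f≡g = cong₂ _+_ (f≡g 0 (s≤s z≤n)) (∑<-cong L (λ j j<L → f≡g (suc j) (s≤s j<L)))

  ∑<-zero : ∀ L {f : ℕ → F} → (∀ j → j < L → f j ≡ 0#) → ∑< L f ≡ 0#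
  ∑<-zero zero    f≡0 = refl
  ∑<-zero (suc L) f≡0 =
    trans (cong₂ _+_ (f≡0 0 (s≤s z≤n)) (∑<-zero L (λ j j<L → f≡0 (suc j) (s≤s j<L)))) (+-identityʳ 0#)

  ∑<-distrib-+ : ∀ L (f g : ℕ → F) → ∑[ j < L ] f j + g j ≡ ∑< L f + ∑< L g
  ∑<-distrib-+ zero    f g = sym (+-identityʳ 0#)
  ∑<-distrib-+ (suc L) f g = trans (cong (f 0 + g 0 +_) (∑<-distrib-+ L _ _))
    (solve 4 (λ a b c d → (a :+ b) :+ (c :+ d) := (a :+ c) :+ (b :+ d)) refl (f 0) (g 0) _ _)

  *-distribˡ-∑< : ∀ L x (f : ℕ → F) → x * ∑< L f ≡ ∑[ j < L ] x * f j
  *-distribˡ-∑< zero    x f = zeroʳ x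
  *-distribˡ-∑< (suc L) x f = trans (distribˡ x _ _) (cong (x * f 0 +_) (*-distribˡ-∑< L x _))

  -‿distrib-∑< : ∀ L (f : ℕ → F) → - ∑< L f ≡ ∑[ j < L ] - f j
  -‿distrib-∑< zero    f = trans (sym (+-identityˡ (- 0#))) (-‿inverseʳ 0#)
  -‿distrib-∑< (suc L) f = trans (sym (⁻¹-∙-comm (f 0) _)) (cong (- f 0 +_) (-‿distrib-∑< L _))

  ∑<-init-last : ∀ L (f : ℕ → F) → ∑< (suc L) f ≡ ∑< L f + f L
  ∑<-init-last zero    f = trans (+-identityʳ _) (sym (+-identityˡ _))
  ∑<-init-last (suc L) f = trans (cong (f 0 +_) (∑<-init-last L _)) (sym (+-assoc _ _ _))

  ∑<-split : ∀ L M (f : ℕ → F) → ∑< (L ℕ.+ M) f ≡ ∑< L f + (∑[ j < M ] f (L ℕ.+ j))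
  ∑<-split zero    M f = sym (+-identityˡ _)
  ∑<-split (suc L) M f = trans (cong (f 0 +_) (∑<-split L M _)) (sym (+-assoc _ _ _))

  ∑<-single : ∀ L k (f : ℕ → F) → k < L → (∀ j → j < L → ¬ (j ≡ k) → f j ≡ 0#) → ∑< L f ≡ f k
  ∑<-single (suc L) zero f _ f≡0 =
    trans (cong (f 0 +_) (∑<-zero L (λ j j<L → f≡0 (suc j) (s≤s j<L) (λ ())))) (+-identityʳ _)
  ∑<-single (suc L) (suc k) f (s≤s k<L) f≡0 = begin
    f 0 + ∑< L (λ j → f (suc j))
      ≡⟨ cong (_+ ∑< L (λ j → f (suc j))) (f≡0 0 (s≤s z≤n) (λ ())) ⟩
    0# + ∑< L (λ j → f (suc j))
      ≡⟨ +-identityˡ _ ⟩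
    ∑< L (λ j → f (suc j))
      ≡⟨ ∑<-single L k _ k<L (λ j j<L j≢k → f≡0 (suc j) (s≤s j<L) (j≢k ∘ ℕP.suc-injective)) ⟩
    f (suc k) ∎

  sum-cong : ∀ {n} {f g : Fin n → F} → (∀ i → f i ≡ g i) → sum f ≡ sum g
  sum-cong {zero}  f≡g = refl
  sum-cong {suc n} f≡g = cong₂ _+_ (f≡g Fin.zero) (sum-cong (λ i → f≡g (Fin.suc i)))

  sum-zero : ∀ {n} (f : Fin n → F) → (∀ i → f i ≡ 0#) → sum f ≡ 0#
  sum-zero {zero}  f f≡0 = refl
  sum-zero {suc n} f f≡0 =
    trans (cong₂ _+_ (f≡0 Fin.zero) (sum-zero (λ i → f (Fin.suc i)) (λ i → f≡0 (Fin.suc i)))) (+-identityʳ 0#)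

  sum-distrib-+ : ∀ {n} (f g : Fin n → F) → sum (λ i → f i + g i) ≡ sum f + sum g
  sum-distrib-+ {zero}  f g = sym (+-identityʳ 0#)
  sum-distrib-+ {suc n} f g =
    trans (cong (f Fin.zero + g Fin.zero +_) (sum-distrib-+ (f ∘ Fin.suc) (g ∘ Fin.suc)))
    (solve 4 (λ a b c d → (a :+ b) :+ (c :+ d) := (a :+ c) :+ (b :+ d)) refl (f Fin.zero) (g Fin.zero) _ _)

  *-distribˡ-sum : ∀ {n} x (f : Fin n → F) → x * sum f ≡ sum (λ i → x * f i)
  *-distribˡ-sum {zero}  x f = zeroʳ x
  *-distribˡ-sum {suc n} x f = trans (distribˡ x _ _) (cong (x * f Fin.zero +_) (*-distribˡ-sum x (λ i → f (Fin.suc i))))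

  sum-∑<-comm : ∀ {n} L (g : Fin n → ℕ → F) → sum (λ i → ∑< L (g i)) ≡ ∑[ j < L ] sum (λ i → g i j)
  sum-∑<-comm {n} zero g = sum-zero {n} (λ _ → 0#) (λ _ → refl)
  sum-∑<-comm (suc L) g = trans (sum-distrib-+ (λ i → g i 0) (λ i → ∑< L (λ j → g i (suc j))))
    (cong (sum (λ i → g i 0) +_) (sum-∑<-comm L (λ i j → g i (suc j))))

  -- Hasse derivatives and linear factors

  -- The k-th Hasse derivative at c of the polynomial ∑_{j<L} p_j x^j.
  hasse : ℕ → (ℕ → F) → F → ℕ → F
  hasse L p c k = ∑[ j < L ] p j * (fromℕ (j C k) * c ^ (j ∸ k))

  mulX : (ℕ → F) → ℕ → F
  mulX r zero    = 0#
  mulX r (suc j) = r j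

  -- p = (x + β)·r as polynomials of degree at most L, where r has degree below L.
  record LinearFactorisation (L : ℕ) (p : ℕ → F) (β : F) (r : ℕ → F) : Set where
    constructor linearFactorisation
    field
      coefficients : ∀ j → j < suc L → p j ≡ mulX r j + β * r j
      top-zero     : r L ≡ 0#

  -- For j ≤ k truncated subtraction makes both exponents 0, but then the binomial coefficient vanishes.
  C-power-step : ∀ j k c → fromℕ (j C suc k) * c ^ (j ∸ k) ≡ c * (fromℕ (j C suc k) * c ^ (j ∸ suc k))
  C-power-step j k c with ℕP.≤-<-connex j k
  ... | inj₁ j≤k = begin
    fromℕ (j C suc k) * c ^ (j ∸ k)
      ≡⟨ cong (_* c ^ (j ∸ k)) (fromℕ-C-vanishes (s≤s j≤k)) ⟩
    0# * c ^ (j ∸ k)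
      ≡⟨ zeroˡ _ ⟩
    0#
      ≡⟨ sym (trans (cong (c *_) (zeroˡ _)) (zeroʳ c)) ⟩
    c * (0# * c ^ (j ∸ suc k))
      ≡⟨ cong (λ z → c * (z * c ^ (j ∸ suc k))) (sym (fromℕ-C-vanishes (s≤s j≤k))) ⟩
    c * (fromℕ (j C suc k) * c ^ (j ∸ suc k)) ∎
  ... | inj₂ k<j = begin
    fromℕ (j C suc k) * c ^ (j ∸ k)
      ≡⟨ cong (λ e → fromℕ (j C suc k) * c ^ e) (ℕP.+-∸-assoc 1 k<j) ⟩
    fromℕ (j C suc k) * (c * c ^ (j ∸ suc k))
      ≡⟨ solve 3 (λ x y z → x :* (y :* z) := y :* (x :* z)) refl (fromℕ (j C suc k)) c _ ⟩
    c * (fromℕ (j C suc k) * c ^ (j ∸ suc k)) ∎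

  hasse-linearFactorisation : ∀ {L p β r} c k → LinearFactorisation L p β r →
    hasse (suc L) p c k ≡ (∑[ j < L ] r j * (fromℕ (suc j C k) * c ^ (suc j ∸ k))) + β * hasse L r c k
  hasse-linearFactorisation {L} {p} {β} {r} c k (linearFactorisation p≡[x+β]r rL≡0) = begin
    hasse (suc L) p c k
      ≡⟨ ∑<-cong (suc L) (λ j j≤L → trans (cong (_* X j) (p≡[x+β]r j j≤L)) (distribʳ (X j) _ _)) ⟩
    ∑[ j < suc L ] mulX r j * X j + β * r j * X j
      ≡⟨ ∑<-distrib-+ (suc L) (λ j → mulX r j * X j) (λ j → β * r j * X j) ⟩
    (∑[ j < suc L ] mulX r j * X j) + (∑[ j < suc L ] β * r j * X j)
      ≡⟨ cong₂ _+_ shifted scaled ⟩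
    (∑[ j < L ] r j * X (suc j)) + β * hasse L r c k ∎
    where
    X : ℕ → F
    X j = fromℕ (j C k) * c ^ (j ∸ k)
    shifted : ∑[ j < suc L ] mulX r j * X j ≡ ∑[ j < L ] r j * X (suc j)
    shifted = trans (cong (_+ (∑[ j < L ] r j * X (suc j))) (zeroˡ _)) (+-identityˡ _)
    scaled : ∑[ j < suc L ] β * r j * X j ≡ β * hasse L r c k
    scaled = begin
      ∑[ j < suc L ] β * r j * X j
        ≡⟨ ∑<-init-last L _ ⟩
      (∑[ j < L ] β * r j * X j) + β * r L * X L
        ≡⟨ cong (λ z → (∑[ j < L ] β * r j * X j) + β * z * X L) rL≡0 ⟩
      (∑[ j < L ] β * r j * X j) + β * 0# * X L
        ≡⟨ cong ((∑[ j < L ] β * r j * X j) +_) (trans (cong (_* X L) (zeroʳ β)) (zeroˡ _)) ⟩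
      (∑[ j < L ] β * r j * X j) + 0#
        ≡⟨ +-identityʳ _ ⟩
      ∑[ j < L ] β * r j * X j
        ≡⟨ ∑<-cong L (λ j _ → *-assoc β _ _) ⟩
      ∑[ j < L ] β * (r j * X j)
        ≡⟨ sym (*-distribˡ-∑< L β _) ⟩
      β * hasse L r c k ∎

  hasse-zero-linearFactorisation : ∀ {L p β r} c → LinearFactorisation L p β r →
    hasse (suc L) p c 0 ≡ (c + β) * hasse L r c 0
  hasse-zero-linearFactorisation {L} {p} {β} {r} c fact = begin
    hasse (suc L) p c 0
      ≡⟨ hasse-linearFactorisation c 0 fact ⟩
    (∑[ j < L ] r j * (fromℕ 1 * c ^ suc j)) + β * hasse L r c 0
      ≡⟨ cong (_+ β * hasse L r c 0) (∑<-cong L (λ j _ →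
        solve 4 (λ x y z w → x :* (y :* (z :* w)) := z :* (x :* (y :* w))) refl (r j) (fromℕ 1) c (c ^ j))) ⟩
    (∑[ j < L ] c * (r j * (fromℕ 1 * c ^ j))) + β * hasse L r c 0
      ≡⟨ cong (_+ β * hasse L r c 0) (sym (*-distribˡ-∑< L c _)) ⟩
    c * hasse L r c 0 + β * hasse L r c 0
      ≡⟨ sym (distribʳ _ c β) ⟩
    (c + β) * hasse L r c 0 ∎

  hasse-suc-linearFactorisation : ∀ {L p β r} c k → LinearFactorisation L p β r →
    hasse (suc L) p c (suc k) ≡ hasse L r c k + (c + β) * hasse L r c (suc k)
  hasse-suc-linearFactorisation {L} {p} {β} {r} c k fact = begin
    hasse (suc L) p c (suc k)
      ≡⟨ hasse-linearFactorisation c (suc k) fact ⟩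
    (∑[ j < L ] r j * (fromℕ (suc j C suc k) * c ^ (j ∸ k))) + β * D′
      ≡⟨ cong (_+ β * D′) (∑<-cong L (λ j _ → pascal-term j)) ⟩
    (∑[ j < L ] r j * X k j + c * (r j * X (suc k) j)) + β * D′
      ≡⟨ cong (_+ β * D′) (∑<-distrib-+ L (λ j → r j * X k j) (λ j → c * (r j * X (suc k) j))) ⟩
    hasse L r c k + (∑[ j < L ] c * (r j * X (suc k) j)) + β * D′
      ≡⟨ cong (λ z → hasse L r c k + z + β * D′) (sym (*-distribˡ-∑< L c _)) ⟩
    hasse L r c k + c * D′ + β * D′
      ≡⟨ solve 4 (λ a x y t → a :+ x :* t :+ y :* t := a :+ (x :+ y) :* t) refl (hasse L r c k) c β D′ ⟩
    hasse L r c k + (c + β) * D′ ∎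
    where
    D′ = hasse L r c (suc k)
    X : ℕ → ℕ → F
    X i j = fromℕ (j C i) * c ^ (j ∸ i)
    pascal-term : ∀ j → r j * (fromℕ (suc j C suc k) * c ^ (j ∸ k)) ≡ r j * X k j + c * (r j * X (suc k) j)
    pascal-term j = begin
      r j * (fromℕ (suc j C suc k) * c ^ (j ∸ k))
        ≡⟨ cong (λ z → r j * (z * c ^ (j ∸ k))) (fromℕ-pascal j k) ⟩
      r j * ((fromℕ (j C k) + fromℕ (j C suc k)) * c ^ (j ∸ k))
        ≡⟨ cong (r j *_) (distribʳ _ _ _) ⟩
      r j * (X k j + fromℕ (j C suc k) * c ^ (j ∸ k))
        ≡⟨ cong (λ z → r j * (X k j + z)) (C-power-step j k c) ⟩
      r j * (X k j + c * X (suc k) j)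
        ≡⟨ solve 4 (λ a x y z → a :* (x :+ y :* z) := a :* x :+ y :* (a :* z)) refl (r j) (X k j) c (X (suc k) j) ⟩
      r j * X k j + c * (r j * X (suc k) j) ∎

  binomialCoeffs : ℕ → F → ℕ → F
  binomialCoeffs N a j = fromℕ (N C j) * a ^ (N ∸ j)

  binomialCoeffs-linearFactorisation : ∀ N a →
    LinearFactorisation (suc N) (binomialCoeffs (suc N) a) a (binomialCoeffs N a)
  binomialCoeffs-linearFactorisation N a =
    linearFactorisation pascal (trans (cong (_* a ^ (N ∸ suc N)) (fromℕ-C-vanishes (ℕP.n<1+n N))) (zeroˡ _))
    where
    pascal : ∀ j → j < suc (suc N) → binomialCoeffs (suc N) a j ≡ mulX (binomialCoeffs N a) j + a * binomialCoeffs N a j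
    pascal zero    _ = solve 3 (λ o x y → o :* (x :* y) := con 0 :+ x :* (o :* y)) refl (fromℕ 1) a (a ^ N)
    pascal (suc j) _ = begin
      fromℕ (suc N C suc j) * a ^ (N ∸ j)
        ≡⟨ cong (_* a ^ (N ∸ j)) (fromℕ-pascal N j) ⟩
      (fromℕ (N C j) + fromℕ (N C suc j)) * a ^ (N ∸ j)
        ≡⟨ distribʳ _ _ _ ⟩
      binomialCoeffs N a j + fromℕ (N C suc j) * a ^ (N ∸ j)
        ≡⟨ cong (binomialCoeffs N a j +_) (C-power-step N j a) ⟩
      binomialCoeffs N a j + a * binomialCoeffs N a (suc j) ∎

  hasse-binomialCoeffs : ∀ N a c k → hasse (suc N) (binomialCoeffs N a) c k ≡ fromℕ (N C k) * (c + a) ^ (N ∸ k)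
  hasse-binomialCoeffs zero a c zero    = solve 1 (λ y → (con 1 :+ con 0) :* con 1 :* y :+ con 0 := y) refl _
  hasse-binomialCoeffs zero a c (suc k) = solve 1 (λ y → (con 1 :+ con 0) :* con 1 :* y :+ con 0 := y) refl _
  hasse-binomialCoeffs (suc N) a c zero = begin
    hasse (suc (suc N)) (binomialCoeffs (suc N) a) c 0
      ≡⟨ hasse-zero-linearFactorisation c (binomialCoeffs-linearFactorisation N a) ⟩
    (c + a) * hasse (suc N) (binomialCoeffs N a) c 0
      ≡⟨ cong ((c + a) *_) (hasse-binomialCoeffs N a c 0) ⟩
    (c + a) * (fromℕ 1 * (c + a) ^ N)
      ≡⟨ solve 3 (λ y o z → y :* (o :* z) := o :* (y :* z)) refl (c + a) (fromℕ 1) _ ⟩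
    fromℕ 1 * (c + a) ^ suc N ∎
  hasse-binomialCoeffs (suc N) a c (suc k) = begin
    hasse (suc (suc N)) (binomialCoeffs (suc N) a) c (suc k)
      ≡⟨ hasse-suc-linearFactorisation c k (binomialCoeffs-linearFactorisation N a) ⟩
    hasse (suc N) (binomialCoeffs N a) c k + y * hasse (suc N) (binomialCoeffs N a) c (suc k)
      ≡⟨ cong₂ (λ u v → u + y * v) (hasse-binomialCoeffs N a c k) (hasse-binomialCoeffs N a c (suc k)) ⟩
    fromℕ (N C k) * y ^ (N ∸ k) + y * (fromℕ (N C suc k) * y ^ (N ∸ suc k))
      ≡⟨ cong (fromℕ (N C k) * y ^ (N ∸ k) +_) (sym (C-power-step N k y)) ⟩
    fromℕ (N C k) * y ^ (N ∸ k) + fromℕ (N C suc k) * y ^ (N ∸ k)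
      ≡⟨ sym (distribʳ _ _ _) ⟩
    (fromℕ (N C k) + fromℕ (N C suc k)) * y ^ (N ∸ k)
      ≡⟨ cong (_* y ^ (N ∸ k)) (sym (fromℕ-pascal N k)) ⟩
    fromℕ (suc N C suc k) * y ^ (N ∸ k) ∎
    where y = c + a

  binomial-expansion : ∀ N a c → (c + a) ^ N ≡ ∑[ j < suc N ] binomialCoeffs N a j * c ^ j
  binomial-expansion N a c = begin
    (c + a) ^ N
      ≡⟨ sym (trans (cong (_* (c + a) ^ N) fromℕ-1) (*-identityˡ _)) ⟩
    fromℕ (N C 0) * (c + a) ^ (N ∸ 0)
      ≡⟨ sym (hasse-binomialCoeffs N a c 0) ⟩
    hasse (suc N) (binomialCoeffs N a) c 0
      ≡⟨ ∑<-cong (suc N) (λ j _ → cong (binomialCoeffs N a j *_) (trans (cong (_* c ^ j) fromℕ-1) (*-identityˡ _))) ⟩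
    ∑[ j < suc N ] binomialCoeffs N a j * c ^ j ∎

  constant : F → ℕ → F
  constant y zero    = y
  constant y (suc _) = 0#

  constant-suc : ∀ y {k} → ¬ (k ≡ 0) → constant y k ≡ 0#
  constant-suc y {zero}  k≢0 = ⊥-elim (k≢0 refl)
  constant-suc y {suc k} _   = refl

  C*constant≡constant : ∀ N y k → fromℕ (N C k) * constant y k ≡ constant y k
  C*constant≡constant N y zero    = trans (cong (_* y) fromℕ-1) (*-identityˡ y)
  C*constant≡constant N y (suc k) = zeroʳ _

  hasse-constant : ∀ L y c k → hasse (suc L) (constant y) c k ≡ constant y k
  hasse-constant L y c zero    = trans (cong₂ _+_ (solve 1 (λ y → y :* ((con 1 :+ con 0) :* con 1) := y) refl y)
                                                  (∑<-zero L (λ j _ → zeroˡ _)))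
                                       (+-identityʳ y)
  hasse-constant L y c (suc k) = trans (cong₂ _+_ (trans (cong (y *_) (zeroˡ _)) (zeroʳ y)) (∑<-zero L (λ j _ → zeroˡ _)))
                                       (+-identityʳ _)

  hasse-sub : ∀ L (f g : ℕ → F) c k → hasse L (λ j → f j + - g j) c k ≡ hasse L f c k + - hasse L g c k
  hasse-sub L f g c k = begin
    hasse L (λ j → f j + - g j) c k
      ≡⟨ ∑<-cong L (λ j _ → trans (distribʳ _ (f j) (- g j)) (cong (f j * X j +_) (sym (-‿distribˡ-* (g j) (X j))))) ⟩
    ∑[ j < L ] f j * X j + - (g j * X j)
      ≡⟨ ∑<-distrib-+ L (λ j → f j * X j) (λ j → - (g j * X j)) ⟩
    hasse L f c k + (∑[ j < L ] - (g j * X j))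
      ≡⟨ cong (hasse L f c k +_) (sym (-‿distrib-∑< L _)) ⟩
    hasse L f c k + - hasse L g c k ∎
    where
    X : ℕ → F
    X j = fromℕ (j C k) * c ^ (j ∸ k)

  -- Synthetic division by x − b.
  quotientBy : ℕ → (ℕ → F) → F → ℕ → F
  quotientBy L p b j = ∑[ t < L ∸ j ] p (suc j ℕ.+ t) * b ^ t

  quotientBy-horner : ∀ L p b j → j < L → quotientBy L p b j ≡ p (suc j) + b * quotientBy L p b (suc j)
  quotientBy-horner L p b j j<L = begin
    quotientBy L p b j
      ≡⟨ cong (λ K → ∑< K (λ t → p (suc j ℕ.+ t) * b ^ t)) (ℕP.+-∸-assoc 1 j<L) ⟩
    p (suc j ℕ.+ 0) * 1# + (∑[ t < L ∸ suc j ] p (suc j ℕ.+ suc t) * b ^ suc t)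
      ≡⟨ cong₂ _+_ (trans (*-identityʳ _) (cong p (ℕP.+-identityʳ (suc j)))) (∑<-cong (L ∸ suc j) (λ t _ → shift t)) ⟩
    p (suc j) + (∑[ t < L ∸ suc j ] b * (p (suc (suc j) ℕ.+ t) * b ^ t))
      ≡⟨ cong (p (suc j) +_) (sym (*-distribˡ-∑< (L ∸ suc j) b _)) ⟩
    p (suc j) + b * quotientBy L p b (suc j) ∎
    where
    shift : ∀ t → p (suc j ℕ.+ suc t) * b ^ suc t ≡ b * (p (suc (suc j) ℕ.+ t) * b ^ t)
    shift t = trans (cong (λ i → p i * b ^ suc t) (ℕP.+-suc (suc j) t))
                    (solve 3 (λ x y z → x :* (y :* z) := y :* (x :* z)) refl (p (suc (suc j) ℕ.+ t)) b (b ^ t))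

  quotientBy-eval : ∀ L p b → p 0 + b * quotientBy L p b 0 ≡ hasse (suc L) p b 0
  quotientBy-eval L p b = cong₂ _+_
    (sym (trans (cong (λ z → p 0 * (z * 1#)) fromℕ-1) (solve 1 (λ x → x :* (con 1 :* con 1) := x) refl (p 0))))
    (trans (*-distribˡ-∑< L b _) (∑<-cong L (λ t _ →
      trans (solve 3 (λ x y z → x :* (y :* z) := y :* (con 1 :* (x :* z))) refl b (p (suc t)) (b ^ t))
            (cong (λ z → p (suc t) * (z * b ^ suc t)) (sym fromℕ-1)))))

  factor-theorem : ∀ L p b → hasse (suc L) p b 0 ≡ 0# → LinearFactorisation L p (- b) (quotientBy L p b)
  factor-theorem L p b p[b]≡0 =
    linearFactorisation coefficients (cong (λ K → ∑< K (λ t → p (suc L ℕ.+ t) * b ^ t)) (ℕP.n∸n≡0 L))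
    where
    r = quotientBy L p b
    coefficients : ∀ j → j < suc L → p j ≡ mulX r j + - b * r j
    coefficients zero _ = begin
      p 0             ≡⟨ inverseˡ-unique (p 0) (b * r 0) (trans (quotientBy-eval L p b) p[b]≡0) ⟩
      - (b * r 0)     ≡⟨ -‿distribˡ-* b (r 0) ⟩
      - b * r 0       ≡⟨ sym (+-identityˡ _) ⟩
      0# + - b * r 0  ∎
    coefficients (suc j) (s≤s j<L) = begin
      p (suc j)
        ≡⟨ sym (x+y-y≡x (p (suc j)) (b * r (suc j))) ⟩
      p (suc j) + b * r (suc j) + - (b * r (suc j))
        ≡⟨ cong₂ _+_ (sym (quotientBy-horner L p b j j<L)) (-‿distribˡ-* b (r (suc j))) ⟩
      r j + - b * r (suc j) ∎

  linearFactorisation-zero : ∀ {L p β r} → LinearFactorisation L p β r →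
    (∀ j → j < L → r j ≡ 0#) → ∀ j → j < suc L → p j ≡ 0#
  linearFactorisation-zero {L} {p} {β} {r} (linearFactorisation p≡[x+β]r rL≡0) r≡0 j j≤L = begin
    p j                 ≡⟨ p≡[x+β]r j j≤L ⟩
    mulX r j + β * r j  ≡⟨ cong₂ (λ u v → u + β * v) (mulX-zero j j≤L) (r≡0′ j j≤L) ⟩
    0# + β * 0#         ≡⟨ trans (+-identityˡ _) (zeroʳ β) ⟩
    0#                  ∎
    where
    r≡0′ : ∀ j → j < suc L → r j ≡ 0#
    r≡0′ j (s≤s j≤L) with ℕP.m≤n⇒m<n∨m≡n j≤L
    ... | inj₁ j<L  = r≡0 j j<L
    ... | inj₂ refl = rL≡0
    mulX-zero : ∀ j → j < suc L → mulX r j ≡ 0#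
    mulX-zero zero    _        = refl
    mulX-zero (suc j) (s≤s j<L) = r≡0 j j<L

  -- Zeros with multiplicity

  VanishesTo : ℕ → (ℕ → F) → F × ℕ → Set
  VanishesTo L p (b , o) = ∀ k → k < o → hasse L p b k ≡ 0#

  totalMultiplicity : List (F × ℕ) → ℕ
  totalMultiplicity ps = ℕᴸ.sum (List.map proj₂ ps)

  Distinct : List (F × ℕ) → Set
  Distinct = AllPairs (λ u v → ¬ (proj₁ u ≡ proj₁ v))

  quotient-vanishes-at-root : ∀ {L p b o} → VanishesTo (suc L) p (b , suc o) → VanishesTo L (quotientBy L p b) (b , o)
  quotient-vanishes-at-root {L} {p} {b} {o} p-vanishes k k<o = begin
    hasse L r b k
      ≡⟨ sym (+-identityʳ _) ⟩
    hasse L r b k + 0#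
      ≡⟨ cong (hasse L r b k +_) (sym (trans (cong (_* hasse L r b (suc k)) (-‿inverseʳ b)) (zeroˡ _))) ⟩
    hasse L r b k + (b + - b) * hasse L r b (suc k)
      ≡⟨ sym (hasse-suc-linearFactorisation b k (factor-theorem L p b (p-vanishes 0 (s≤s z≤n)))) ⟩
    hasse (suc L) p b (suc k)
      ≡⟨ p-vanishes (suc k) (s≤s k<o) ⟩
    0# ∎
    where r = quotientBy L p b

  quotient-vanishes-elsewhere : ∀ {L p b c o} → hasse (suc L) p b 0 ≡ 0# → ¬ (b ≡ c) →
    VanishesTo (suc L) p (c , o) → VanishesTo L (quotientBy L p b) (c , o)
  quotient-vanishes-elsewhere {L} {p} {b} {c} {o} p[b]≡0 b≢c p-vanishes = vanishes
    where
    r = quotientBy L p b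
    fact = factor-theorem L p b p[b]≡0
    c-b≢0 : ¬ (c + - b ≡ 0#)
    c-b≢0 = x≢y⇒x-y≢0 (λ c≡b → b≢c (sym c≡b))
    vanishes : ∀ k → k < o → hasse L r c k ≡ 0#
    vanishes zero    0<o = x*y≡0⇒y≡0 c-b≢0 (trans (sym (hasse-zero-linearFactorisation c fact)) (p-vanishes 0 0<o))
    vanishes (suc k) k<o = x*y≡0⇒y≡0 c-b≢0 (begin
      (c + - b) * hasse L r c (suc k)
        ≡⟨ sym (+-identityˡ _) ⟩
      0# + (c + - b) * hasse L r c (suc k)
        ≡⟨ cong (_+ (c + - b) * hasse L r c (suc k)) (sym (vanishes k (ℕP.<-trans (ℕP.n<1+n k) k<o))) ⟩
      hasse L r c k + (c + - b) * hasse L r c (suc k)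
        ≡⟨ sym (hasse-suc-linearFactorisation c k fact) ⟩
      hasse (suc L) p c (suc k)
        ≡⟨ p-vanishes (suc k) k<o ⟩
      0# ∎)

  -- Divide by x − b for a point b of positive order: the quotient still vanishes at the other (distinct)
  -- points to the same order, and at b to one order less.
  coefficients-vanish : ∀ L p ps → Distinct ps → All (VanishesTo L p) ps → L ≤ totalMultiplicity ps →
    ∀ j → j < L → p j ≡ 0#
  coefficients-vanish zero p ps _ _ _ j ()
  coefficients-vanish (suc L) p ((b , zero) ∷ ps) (_ ∷ distinct) (_ ∷ vanish) L≤m =
    coefficients-vanish (suc L) p ps distinct vanish L≤m
  coefficients-vanish (suc L) p ((b , suc o) ∷ ps) (b∉ps ∷ distinct) (vanish-b ∷ vanish) (s≤s L≤m) =
    linearFactorisation-zero (factor-theorem L p b p[b]≡0) quotient-zero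
    where
    p[b]≡0 : hasse (suc L) p b 0 ≡ 0#
    p[b]≡0 = vanish-b 0 (s≤s z≤n)
    quotient-zero : ∀ j → j < L → quotientBy L p b j ≡ 0#
    quotient-zero = coefficients-vanish L (quotientBy L p b) ((b , o) ∷ ps) (b∉ps ∷ distinct)
      (quotient-vanishes-at-root {L} {p} vanish-b
        ∷ All.zipWith (λ (b≢c , vanish-c) → quotient-vanishes-elsewhere {L} {p} p[b]≡0 b≢c vanish-c) (b∉ps , vanish))
      L≤m

  totalMultiplicity-uniform : ∀ o xs → totalMultiplicity (List.map (_, o) xs) ≡ List.length xs ℕ.* o
  totalMultiplicity-uniform o []       = refl
  totalMultiplicity-uniform o (x ∷ xs) = cong (o ℕ.+_) (totalMultiplicity-uniform o xs)

  coefficients-vanish-uniform : ∀ L p o xs → Unique xs → All (λ x → VanishesTo L p (x , o)) xs →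
    L ≤ List.length xs ℕ.* o → ∀ j → j < L → p j ≡ 0#
  coefficients-vanish-uniform L p o xs unique vanish L≤m = coefficients-vanish L p (List.map (_, o) xs)
    (AllPairs.map⁺ unique) (All.map⁺ vanish) (subst (L ≤_) (sym (totalMultiplicity-uniform o xs)) L≤m)

  -- `auxiliary` is ∑ᵢ cᵢ (x + aᵢ)^N − 1 with N = n′ + e. Its coefficients above e are multiples of moments
  -- of c of order below n′, hence vanish. At each bₗ its k-th Hasse derivative, k ≤ n′, is
  -- C(N, k) ∑ᵢ cᵢ (bₗ + aᵢ)^(N−k) − [k = 0]; as (bₗ + aᵢ)^e = 1 the exponent drops to n′ − k, and
  -- expanding in powers of aᵢ leaves only the moment of order n′, so the derivative vanishes.
  module Stepanov {n′ e m : ℕ} (a c : Fin (suc n′) → F) (b : Fin m → F)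
    (c-low : ∀ j → j < n′ → sum (λ i → c i * a i ^ j) ≡ 0#)
    (c-top : sum (λ i → c i * a i ^ n′) ≡ 1#)
    (b-injective : Injective _≡_ _≡_ b)
    (sums-in-μₑ : ∀ i k → (a i + b k) ^ e ≡ 1#)
    (e<mn : e < m ℕ.* suc n′) where

    N : ℕ
    N = n′ ℕ.+ e

    moment : ℕ → F
    moment t = sum (λ i → c i * a i ^ t)

    P : ℕ → F
    P j = sum (λ i → c i * binomialCoeffs N (a i) j)

    auxiliary : ℕ → F
    auxiliary j = P j + - constant 1# j

    P-coefficient : ∀ j → P j ≡ fromℕ (N C j) * moment (N ∸ j)
    P-coefficient j = begin
      P j
        ≡⟨ sum-cong (λ i → solve 3 (λ x y z → x :* (y :* z) := y :* (x :* z)) refl (c i) (fromℕ (N C j)) (a i ^ (N ∸ j))) ⟩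
      sum (λ i → fromℕ (N C j) * (c i * a i ^ (N ∸ j)))
        ≡⟨ sym (*-distribˡ-sum (fromℕ (N C j)) (λ i → c i * a i ^ (N ∸ j))) ⟩
      fromℕ (N C j) * moment (N ∸ j) ∎

    P-high : ∀ t → t < n′ → P (suc e ℕ.+ t) ≡ 0#
    P-high t t<n′ = begin
      P (suc e ℕ.+ t)
        ≡⟨ P-coefficient (suc e ℕ.+ t) ⟩
      fromℕ (N C (suc e ℕ.+ t)) * moment (N ∸ (suc e ℕ.+ t))
        ≡⟨ cong (fromℕ (N C (suc e ℕ.+ t)) *_) (c-low _ N∸[1+e+t]<n′) ⟩
      fromℕ (N C (suc e ℕ.+ t)) * 0#
        ≡⟨ zeroʳ _ ⟩
      0# ∎
      where
      N∸[1+e+t]<n′ : N ∸ (suc e ℕ.+ t) < n′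
      N∸[1+e+t]<n′ = subst (_< n′) (sym (begin
        N ∸ (suc e ℕ.+ t)      ≡⟨ cong (N ∸_) (sym (ℕP.+-suc e t)) ⟩
        N ∸ (e ℕ.+ suc t)      ≡⟨ sym (ℕP.∸-+-assoc N e (suc t)) ⟩
        N ∸ e ∸ suc t          ≡⟨ cong (_∸ suc t) (ℕP.m+n∸n≡m n′ e) ⟩
        n′ ∸ suc t             ∎)) (ℕP.∸-monoʳ-< (s≤s z≤n) t<n′)

    hasse-P-truncate : ∀ x k → hasse (suc e) P x k ≡ hasse (suc N) P x k
    hasse-P-truncate x k = begin
      hasse (suc e) P x k
        ≡⟨ sym (+-identityʳ _) ⟩
      hasse (suc e) P x k + 0#
        ≡⟨ cong (hasse (suc e) P x k +_) (sym (∑<-zero n′ (λ t t<n′ → trans (cong (_* X (suc e ℕ.+ t)) (P-high t t<n′))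
                                                                           (zeroˡ _)))) ⟩
      hasse (suc e) P x k + (∑[ t < n′ ] T (suc e ℕ.+ t))
        ≡⟨ sym (∑<-split (suc e) n′ T) ⟩
      ∑< (suc e ℕ.+ n′) T
        ≡⟨ cong (λ M → ∑< (suc M) T) (ℕP.+-comm e n′) ⟩
      hasse (suc N) P x k ∎
      where
      X : ℕ → F
      X j = fromℕ (j C k) * x ^ (j ∸ k)
      T : ℕ → F
      T j = P j * X j

    hasse-P : ∀ x k → hasse (suc N) P x k ≡ sum (λ i → c i * (fromℕ (N C k) * (x + a i) ^ (N ∸ k)))
    hasse-P x k = begin
      hasse (suc N) P x k
        ≡⟨ ∑<-cong (suc N) (λ j _ → distribute j) ⟩
      ∑[ j < suc N ] sum (λ i → c i * (binomialCoeffs N (a i) j * X j))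
        ≡⟨ sym (sum-∑<-comm (suc N) (λ i j → c i * (binomialCoeffs N (a i) j * X j))) ⟩
      sum (λ i → ∑[ j < suc N ] c i * (binomialCoeffs N (a i) j * X j))
        ≡⟨ sum-cong (λ i → sym (*-distribˡ-∑< (suc N) (c i) (λ j → binomialCoeffs N (a i) j * X j))) ⟩
      sum (λ i → c i * hasse (suc N) (binomialCoeffs N (a i)) x k)
        ≡⟨ sum-cong (λ i → cong (c i *_) (hasse-binomialCoeffs N (a i) x k)) ⟩
      sum (λ i → c i * (fromℕ (N C k) * (x + a i) ^ (N ∸ k))) ∎
      where
      X : ℕ → F
      X j = fromℕ (j C k) * x ^ (j ∸ k)
      distribute : ∀ j → P j * X j ≡ sum (λ i → c i * (binomialCoeffs N (a i) j * X j))
      distribute j = begin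
        P j * X j
          ≡⟨ *-comm (P j) (X j) ⟩
        X j * P j
          ≡⟨ *-distribˡ-sum (X j) (λ i → c i * binomialCoeffs N (a i) j) ⟩
        sum (λ i → X j * (c i * binomialCoeffs N (a i) j))
          ≡⟨ sum-cong (λ i → solve 3 (λ u v w → u :* (v :* w) := v :* (w :* u)) refl (X j) (c i) (binomialCoeffs N (a i) j)) ⟩
        sum (λ i → c i * (binomialCoeffs N (a i) j * X j)) ∎

    moment-expansion : ∀ x r → sum (λ i → c i * (x + a i) ^ r) ≡ ∑[ j < suc r ] binomialCoeffs r x j * moment j
    moment-expansion x r = begin
      sum (λ i → c i * (x + a i) ^ r)
        ≡⟨ sum-cong (λ i → cong (c i *_) (trans (cong (_^ r) (+-comm x (a i))) (binomial-expansion r x (a i)))) ⟩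
      sum (λ i → c i * (∑[ j < suc r ] binomialCoeffs r x j * a i ^ j))
        ≡⟨ sum-cong (λ i → *-distribˡ-∑< (suc r) (c i) (λ j → binomialCoeffs r x j * a i ^ j)) ⟩
      sum (λ i → ∑[ j < suc r ] c i * (binomialCoeffs r x j * a i ^ j))
        ≡⟨ sum-∑<-comm (suc r) (λ i j → c i * (binomialCoeffs r x j * a i ^ j)) ⟩
      ∑[ j < suc r ] sum (λ i → c i * (binomialCoeffs r x j * a i ^ j))
        ≡⟨ ∑<-cong (suc r) (λ j _ → trans (sum-cong (λ i →
          solve 3 (λ u v w → u :* (v :* w) := v :* (u :* w)) refl (c i) (binomialCoeffs r x j) (a i ^ j)))
          (sym (*-distribˡ-sum (binomialCoeffs r x j) (λ i → c i * a i ^ j)))) ⟩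
      ∑[ j < suc r ] binomialCoeffs r x j * moment j ∎

    shifted-moment : ∀ x k → k ≤ n′ → sum (λ i → c i * (x + a i) ^ (n′ ∸ k)) ≡ constant 1# k
    shifted-moment x zero _ = begin
      sum (λ i → c i * (x + a i) ^ n′)
        ≡⟨ moment-expansion x n′ ⟩
      ∑[ j < suc n′ ] binomialCoeffs n′ x j * moment j
        ≡⟨ ∑<-init-last n′ _ ⟩
      (∑[ j < n′ ] binomialCoeffs n′ x j * moment j) + binomialCoeffs n′ x n′ * moment n′
        ≡⟨ cong₂ _+_ (∑<-zero n′ (λ j j<n′ → trans (cong (binomialCoeffs n′ x j *_) (c-low j j<n′)) (zeroʳ _)))
          (cong₂ _*_ (cong₂ _*_ (trans (cong fromℕ (nCn≡1 n′)) fromℕ-1) (cong (x ^_) (ℕP.n∸n≡0 n′))) c-top) ⟩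
      0# + 1# * 1# * 1#
        ≡⟨ solve 0 (con 0 :+ con 1 :* con 1 :* con 1 := con 1) refl ⟩
      1# ∎
    shifted-moment x (suc k) k<n′ = begin
      sum (λ i → c i * (x + a i) ^ (n′ ∸ suc k))
        ≡⟨ moment-expansion x (n′ ∸ suc k) ⟩
      ∑[ j < suc (n′ ∸ suc k) ] binomialCoeffs (n′ ∸ suc k) x j * moment j
        ≡⟨ ∑<-zero (suc (n′ ∸ suc k)) (λ j j≤ → trans (cong (binomialCoeffs (n′ ∸ suc k) x j *_) (c-low j (ℕP.<-≤-trans j≤ bound)))
                                                      (zeroʳ _)) ⟩
      0# ∎
      where
      bound : suc (n′ ∸ suc k) ≤ n′
      bound = ℕP.≤-trans (ℕP.≤-reflexive (sym (ℕP.+-∸-assoc 1 k<n′))) (ℕP.m∸n≤m n′ k)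

    auxiliary-vanishes : ∀ l → VanishesTo (suc e) auxiliary (b l , suc n′)
    auxiliary-vanishes l k (s≤s k≤n′) = begin
      hasse (suc e) auxiliary x k
        ≡⟨ hasse-sub (suc e) P (constant 1#) x k ⟩
      hasse (suc e) P x k + - hasse (suc e) (constant 1#) x k
        ≡⟨ cong₂ (λ u v → u + - v) (trans (hasse-P-truncate x k) (hasse-P x k)) (hasse-constant e 1# x k) ⟩
      sum (λ i → c i * (fromℕ (N C k) * (x + a i) ^ (N ∸ k))) + - constant 1# k
        ≡⟨ cong (_+ - constant 1# k) value ⟩
      constant 1# k + - constant 1# k
        ≡⟨ -‿inverseʳ _ ⟩
      0# ∎
      where
      x = b l
      drop-e : ∀ i → (x + a i) ^ (N ∸ k) ≡ (x + a i) ^ (n′ ∸ k)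
      drop-e i = begin
        (x + a i) ^ (N ∸ k)                   ≡⟨ cong ((x + a i) ^_) (ℕP.+-∸-comm e k≤n′) ⟩
        (x + a i) ^ (n′ ∸ k ℕ.+ e)            ≡⟨ ^-homo-* _ (n′ ∸ k) e ⟩
        (x + a i) ^ (n′ ∸ k) * (x + a i) ^ e  ≡⟨ cong (λ z → (x + a i) ^ (n′ ∸ k) * z ^ e) (+-comm x (a i)) ⟩
        (x + a i) ^ (n′ ∸ k) * (a i + x) ^ e  ≡⟨ cong ((x + a i) ^ (n′ ∸ k) *_) (sums-in-μₑ i l) ⟩
        (x + a i) ^ (n′ ∸ k) * 1#             ≡⟨ *-identityʳ _ ⟩
        (x + a i) ^ (n′ ∸ k)                  ∎
      value : sum (λ i → c i * (fromℕ (N C k) * (x + a i) ^ (N ∸ k))) ≡ constant 1# k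
      value = begin
        sum (λ i → c i * (fromℕ (N C k) * (x + a i) ^ (N ∸ k)))
          ≡⟨ sum-cong (λ i → trans (cong (λ z → c i * (fromℕ (N C k) * z)) (drop-e i))
            (solve 3 (λ u v w → u :* (v :* w) := v :* (u :* w)) refl (c i) (fromℕ (N C k)) _)) ⟩
        sum (λ i → fromℕ (N C k) * (c i * (x + a i) ^ (n′ ∸ k)))
          ≡⟨ sym (*-distribˡ-sum (fromℕ (N C k)) (λ i → c i * (x + a i) ^ (n′ ∸ k))) ⟩
        fromℕ (N C k) * sum (λ i → c i * (x + a i) ^ (n′ ∸ k))
          ≡⟨ cong (fromℕ (N C k) *_) (shifted-moment x k k≤n′) ⟩
        fromℕ (N C k) * constant 1# k
          ≡⟨ C*constant≡constant N 1# k ⟩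
        constant 1# k ∎

    auxiliary-zero : ∀ j → j < suc e → auxiliary j ≡ 0#
    auxiliary-zero = coefficients-vanish-uniform (suc e) auxiliary (suc n′) (List.tabulate b)
      (Unique.tabulate⁺ b-injective) (All.tabulate⁺ auxiliary-vanishes)
      (subst (λ l → suc e ≤ l ℕ.* suc n′) (sym (List.length-tabulate b)) e<mn)

    moment-identity : ∀ j → j ≤ e → fromℕ (N C j) * moment (N ∸ j) ≡ constant 1# j
    moment-identity j j≤e = begin
      fromℕ (N C j) * moment (N ∸ j)  ≡⟨ sym (P-coefficient j) ⟩
      P j                             ≡⟨ inverseˡ-unique (P j) (- constant 1# j) (auxiliary-zero j (s≤s j≤e)) ⟩
      - - constant 1# j               ≡⟨ -‿involutive _ ⟩
      constant 1# j                   ∎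

    top-moment : moment N ≡ 1#
    top-moment = trans (sym (trans (cong (_* moment N) fromℕ-1) (*-identityˡ _))) (moment-identity 0 z≤n)

    low-moment : ∀ j → j < N → fromℕ (N C j) * moment j ≡ 0#
    low-moment j j<N with j ℕP.<? n′
    ... | yes j<n′ = trans (cong (fromℕ (N C j) *_) (c-low j j<n′)) (zeroʳ _)
    ... | no  j≮n′ = begin
      fromℕ (N C j) * moment j          ≡⟨ cong₂ (λ u v → fromℕ u * moment v) (sym C-symmetric) (sym N∸j′≡j) ⟩
      fromℕ (N C j′) * moment (N ∸ j′)  ≡⟨ moment-identity j′ j′≤e ⟩
      constant 1# j′                    ≡⟨ constant-suc 1# j′≢0 ⟩
      0#                                ∎
      where
      j′ = N ∸ j
      j′≤e : j′ ≤ e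
      j′≤e = ℕP.≤-trans (ℕP.∸-monoʳ-≤ N (ℕP.≮⇒≥ j≮n′)) (ℕP.≤-reflexive (ℕP.m+n∸m≡n n′ e))
      j′≢0 : ¬ (j′ ≡ 0)
      j′≢0 j′≡0 = ℕP.<⇒≢ j<N (sym (trans (sym (ℕP.m∸n+n≡m (ℕP.<⇒≤ j<N))) (cong (ℕ._+ j) j′≡0)))
      N∸j′≡j : N ∸ j′ ≡ j
      N∸j′≡j = ℕP.m∸[m∸n]≡n (ℕP.<⇒≤ j<N)
      C-symmetric : N C j′ ≡ N C j
      C-symmetric = trans (nCk≡nC[n∸k] (ℕP.m∸n≤m N j)) (cong (N C_) N∸j′≡j)

    C[N,e]≡0 : ¬ (e ≡ 0) → fromℕ (N C e) ≡ 0#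
    C[N,e]≡0 e≢0 = begin
      fromℕ (N C e)
        ≡⟨ sym (*-identityʳ _) ⟩
      fromℕ (N C e) * 1#
        ≡⟨ cong (fromℕ (N C e) *_) (sym (trans (cong moment (ℕP.m+n∸n≡m n′ e)) c-top)) ⟩
      fromℕ (N C e) * moment (N ∸ e)
        ≡⟨ moment-identity e ℕP.≤-refl ⟩
      constant 1# e
        ≡⟨ constant-suc 1# e≢0 ⟩
      0# ∎

  -- Dual Vandermonde vectors

  DualVandermonde : ∀ {n′} → (Fin (suc n′) → F) → (Fin (suc n′) → F) → Set
  DualVandermonde {n′} a c = (∀ j → j < n′ → sum (λ i → c i * a i ^ j) ≡ 0#) × sum (λ i → c i * a i ^ n′) ≡ 1#

  -- (x^j − y^j)/(x − y)
  powerQuotient : F → F → ℕ → F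
  powerQuotient x y j = ∑[ u < j ] y ^ (j ∸ suc u) * x ^ u

  -- Stated for x = z + y so that no subtraction occurs (it is then a semiring identity for the solver).
  power-split : ∀ z y j → (z + y) ^ j ≡ y ^ j + z * powerQuotient (z + y) y j
  power-split z y zero    = sym (trans (cong (1# +_) (zeroʳ z)) (+-identityʳ _))
  power-split z y (suc j) = begin
    (z + y) * (z + y) ^ j
      ≡⟨ cong ((z + y) *_) (power-split z y j) ⟩
    (z + y) * (y ^ j + z * G)
      ≡⟨ solve 4 (λ Z Y YJ GG → (Z :+ Y) :* (YJ :+ Z :* GG) := Y :* YJ :+ Z :* (YJ :* con 1 :+ (Z :+ Y) :* GG)) refl z y (y ^ j) G ⟩
    y * y ^ j + z * (y ^ j * 1# + (z + y) * G)
      ≡⟨ cong (λ t → y * y ^ j + z * (y ^ j * 1# + t)) (*-distribˡ-∑< j (z + y) _) ⟩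
    y * y ^ j + z * (y ^ j * 1# + (∑[ u < j ] (z + y) * (y ^ (j ∸ suc u) * (z + y) ^ u)))
      ≡⟨ cong (λ t → y * y ^ j + z * (y ^ j * 1# + t))
              (∑<-cong j (λ u _ → solve 3 (λ X A B → X :* (A :* B) := A :* (X :* B)) refl (z + y) _ _)) ⟩
    y * y ^ j + z * powerQuotient (z + y) y (suc j) ∎
    where G = powerQuotient (z + y) y j

  power-difference : ∀ x y j → x ^ j ≡ y ^ j + (x + - y) * powerQuotient x y j
  power-difference x y j = subst (λ X → X ^ j ≡ y ^ j + (x + - y) * powerQuotient X y j) x-y+y (power-split (x + - y) y j)
    where
    x-y+y : x + - y + y ≡ x
    x-y+y = trans (cong (x + - y +_) (sym (-‿involutive y))) (x+y-y≡x x (- y))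

  -- From a solution c′ for a ∘ suc, take cᵢ₊₁ = c′ᵢ / (aᵢ₊₁ − a₀) and c₀ = −∑ᵢ cᵢ₊₁; splitting
  -- aᵢ₊₁^j = a₀^j + (aᵢ₊₁ − a₀)·powerQuotient turns the j-th moment of c into ∑_{u<j} a₀^(j−1−u) times
  -- the u-th moment of c′.
  dualVandermonde : ∀ n′ (a : Fin (suc n′) → F) → Injective _≡_ _≡_ a → Σ (Fin (suc n′) → F) (DualVandermonde a)
  dualVandermonde zero     a _           = (λ _ → 1#) , (λ j ()) , trans (+-identityʳ _) (*-identityˡ _)
  dualVandermonde (suc n′) a a-injective = c , c-low , c-top
    where
    a₀ = a Fin.zero
    a′ : Fin (suc n′) → F
    a′ i = a (Fin.suc i)
    IH = dualVandermonde n′ a′ (λ eq → Fin.suc-injective (a-injective eq))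
    c′ = proj₁ IH
    c′-low = proj₁ (proj₂ IH)
    c′-top = proj₂ (proj₂ IH)
    a′-a₀≢0 : ∀ i → ¬ (a′ i + - a₀ ≡ 0#)
    a′-a₀≢0 i = x≢y⇒x-y≢0 (λ eq → Fin.0≢1+n (sym (a-injective eq)))
    w : Fin (suc n′) → F
    w i = proj₁ (inverse (a′ i + - a₀) (a′-a₀≢0 i))
    S = sum (λ i → c′ i * w i)
    c : Fin (suc (suc n′)) → F
    c Fin.zero    = - S
    c (Fin.suc i) = c′ i * w i
    moment′ : ℕ → F
    moment′ u = sum (λ i → c′ i * a′ i ^ u)
    G : Fin (suc n′) → ℕ → F
    G i j = powerQuotient (a′ i) a₀ j

    split-term : ∀ j i → c′ i * w i * a′ i ^ j ≡ a₀ ^ j * (c′ i * w i) + c′ i * G i j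
    split-term j i = begin
      c′ i * w i * a′ i ^ j
        ≡⟨ cong (c′ i * w i *_) (power-difference (a′ i) a₀ j) ⟩
      c′ i * w i * (a₀ ^ j + (a′ i + - a₀) * G i j)
        ≡⟨ solve 5 (λ C W A D g → C :* W :* (A :+ D :* g) := A :* (C :* W) :+ C :* ((D :* W) :* g))
                   refl (c′ i) (w i) (a₀ ^ j) (a′ i + - a₀) (G i j) ⟩
      a₀ ^ j * (c′ i * w i) + c′ i * ((a′ i + - a₀) * w i * G i j)
        ≡⟨ cong (λ t → a₀ ^ j * (c′ i * w i) + c′ i * (t * G i j)) (proj₂ (inverse (a′ i + - a₀) (a′-a₀≢0 i))) ⟩
      a₀ ^ j * (c′ i * w i) + c′ i * (1# * G i j)
        ≡⟨ cong (λ t → a₀ ^ j * (c′ i * w i) + c′ i * t) (*-identityˡ _) ⟩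
      a₀ ^ j * (c′ i * w i) + c′ i * G i j ∎

    cancel-S : ∀ A X → - S * A + (A * S + X) ≡ X
    cancel-S A X = begin
      - S * A + (A * S + X)  ≡⟨ cong (λ t → - S * A + (t + X)) (*-comm A S) ⟩
      - S * A + (S * A + X)  ≡⟨ sym (+-assoc _ _ X) ⟩
      - S * A + S * A + X    ≡⟨ cong (_+ X) (sym (distribʳ A (- S) S)) ⟩
      (- S + S) * A + X      ≡⟨ cong (λ t → t * A + X) (-‿inverseˡ S) ⟩
      0# * A + X             ≡⟨ trans (cong (_+ X) (zeroˡ A)) (+-identityˡ X) ⟩
      X                      ∎

    moment-recursion : ∀ j → sum (λ i → c i * a i ^ j) ≡ ∑[ u < j ] a₀ ^ (j ∸ suc u) * moment′ u
    moment-recursion j = begin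
      - S * a₀ ^ j + sum (λ i → c′ i * w i * a′ i ^ j)
        ≡⟨ cong (- S * a₀ ^ j +_) (trans (sum-cong (split-term j))
          (sum-distrib-+ (λ i → a₀ ^ j * (c′ i * w i)) (λ i → c′ i * G i j))) ⟩
      - S * a₀ ^ j + (sum (λ i → a₀ ^ j * (c′ i * w i)) + sum (λ i → c′ i * G i j))
        ≡⟨ cong (λ t → - S * a₀ ^ j + (t + sum (λ i → c′ i * G i j))) (sym (*-distribˡ-sum (a₀ ^ j) (λ i → c′ i * w i))) ⟩
      - S * a₀ ^ j + (a₀ ^ j * S + sum (λ i → c′ i * G i j))
        ≡⟨ cancel-S (a₀ ^ j) _ ⟩
      sum (λ i → c′ i * G i j)
        ≡⟨ sum-cong (λ i → *-distribˡ-∑< j (c′ i) (λ u → a₀ ^ (j ∸ suc u) * a′ i ^ u)) ⟩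
      sum (λ i → ∑[ u < j ] c′ i * (a₀ ^ (j ∸ suc u) * a′ i ^ u))
        ≡⟨ sum-∑<-comm j (λ i u → c′ i * (a₀ ^ (j ∸ suc u) * a′ i ^ u)) ⟩
      ∑[ u < j ] sum (λ i → c′ i * (a₀ ^ (j ∸ suc u) * a′ i ^ u))
        ≡⟨ ∑<-cong j (λ u _ → trans (sum-cong (λ i →
          solve 3 (λ A B C → A :* (B :* C) := B :* (A :* C)) refl (c′ i) (a₀ ^ (j ∸ suc u)) (a′ i ^ u)))
          (sym (*-distribˡ-sum (a₀ ^ (j ∸ suc u)) (λ i → c′ i * a′ i ^ u)))) ⟩
      ∑[ u < j ] a₀ ^ (j ∸ suc u) * moment′ u ∎

    c-low : ∀ j → j < suc n′ → sum (λ i → c i * a i ^ j) ≡ 0#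
    c-low j (s≤s j≤n′) = trans (moment-recursion j)
      (∑<-zero j (λ u u<j → trans (cong (a₀ ^ (j ∸ suc u) *_) (c′-low u (ℕP.<-≤-trans u<j j≤n′))) (zeroʳ _)))

    c-top : sum (λ i → c i * a i ^ suc n′) ≡ 1#
    c-top = begin
      sum (λ i → c i * a i ^ suc n′)
        ≡⟨ moment-recursion (suc n′) ⟩
      ∑[ u < suc n′ ] a₀ ^ (n′ ∸ u) * moment′ u
        ≡⟨ ∑<-init-last n′ _ ⟩
      (∑[ u < n′ ] a₀ ^ (n′ ∸ u) * moment′ u) + a₀ ^ (n′ ∸ n′) * moment′ n′
        ≡⟨ cong₂ _+_ (∑<-zero n′ (λ u u<n′ → trans (cong (a₀ ^ (n′ ∸ u) *_) (c′-low u u<n′)) (zeroʳ _)))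
          (cong₂ _*_ (cong (a₀ ^_) (ℕP.n∸n≡0 n′)) c′-top) ⟩
      0# + 1# * 1#
        ≡⟨ solve 0 (con 0 :+ con 1 :* con 1 := con 1) refl ⟩
      1# ∎

  -- Fermat's little theorem and the characteristic

  toIndex : F → Fin q
  toIndex = Inverse.to enum

  fromIndex : Fin q → F
  fromIndex = Inverse.from enum

  toIndex-fromIndex : ∀ i → toIndex (fromIndex i) ≡ i
  toIndex-fromIndex = Inverse.strictlyInverseˡ enum

  fromIndex-toIndex : ∀ x → fromIndex (toIndex x) ≡ x
  fromIndex-toIndex = Inverse.strictlyInverseʳ enum

  2≤q : 2 ≤ q
  2≤q = distinct⇒2≤ (toIndex 0#) (toIndex 1#) (λ eq → 0≢1 (Injection.injective (↔⇒↣ enum) eq))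
    where
    distinct⇒2≤ : ∀ {n} (i j : Fin n) → ¬ (i ≡ j) → 2 ≤ n
    distinct⇒2≤ {suc zero}    Fin.zero Fin.zero i≢j = ⊥-elim (i≢j refl)
    distinct⇒2≤ {suc (suc n)} _        _        _   = s≤s (s≤s z≤n)

  1+[q∸1]≡q : suc (q ∸ 1) ≡ q
  1+[q∸1]≡q = trans (ℕP.+-comm 1 (q ∸ 1)) (ℕP.m∸n+n≡m (ℕP.≤-trans (s≤s z≤n) 2≤q))

  open CommutativeRing commutativeRing using (*-commutativeMonoid)
  open import Algebra.Properties.CommutativeMonoid.Sum *-commutativeMonoid using ()
    renaming (sum to ∏; sum-cong-≗ to ∏-cong; sum-permute to ∏-permute; ∑-distrib-+ to ∏-distrib-*)

  ∏-constant : ∀ n x → ∏ {n} (λ _ → x) ≡ x ^ n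
  ∏-constant zero    x = refl
  ∏-constant (suc n) x = cong (x *_) (∏-constant n x)

  ∏-nonzero : ∀ {n} (g : Fin n → F) → (∀ i → ¬ (g i ≡ 0#)) → ¬ (∏ g ≡ 0#)
  ∏-nonzero {zero}  g _   1≡0 = 0≢1 (sym 1≡0)
  ∏-nonzero {suc n} g g≢0     = x*y≢0 (g≢0 Fin.zero) (∏-nonzero (g ∘ Fin.suc) (g≢0 ∘ Fin.suc))

  ∏-ones : ∀ {n} (h : Fin n → F) → (∀ i → h i ≡ 1#) → ∏ h ≡ 1#
  ∏-ones {zero}  h _    = refl
  ∏-ones {suc n} h h≡1 = trans (cong₂ _*_ (h≡1 Fin.zero) (∏-ones (h ∘ Fin.suc) (h≡1 ∘ Fin.suc))) (*-identityʳ 1#)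

  ∏-single : ∀ {n} (h : Fin n → F) i₀ → (∀ i → ¬ (i ≡ i₀) → h i ≡ 1#) → ∏ h ≡ h i₀
  ∏-single {suc n} h Fin.zero     h≡1 =
    trans (cong (h Fin.zero *_) (∏-ones (h ∘ Fin.suc) (λ i → h≡1 (Fin.suc i) (λ ())))) (*-identityʳ _)
  ∏-single {suc n} h (Fin.suc i₀) h≡1 =
    trans (cong₂ _*_ (h≡1 Fin.zero (λ ())) (∏-single (h ∘ Fin.suc) i₀ (λ i i≢i₀ → h≡1 (Fin.suc i) (i≢i₀ ∘ Fin.suc-injective))))
          (*-identityˡ _)

  ifZero : F → F → F → F
  ifZero y u v with y ≟ 0#
  ... | yes _ = u
  ... | no  _ = v

  ifZero-zero : ∀ {y} u v → y ≡ 0# → ifZero y u v ≡ u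
  ifZero-zero {y} u v y≡0 with y ≟ 0#
  ... | yes _   = refl
  ... | no  y≢0 = ⊥-elim (y≢0 y≡0)

  ifZero-nonzero : ∀ {y} u v → ¬ (y ≡ 0#) → ifZero y u v ≡ v
  ifZero-nonzero {y} u v y≢0 with y ≟ 0#
  ... | yes y≡0 = ⊥-elim (y≢0 y≡0)
  ... | no  _   = refl

  scaling : ∀ x → ¬ (x ≡ 0#) → Perm.Permutation q q
  scaling x x≢0 =
    Perm.permutation (multiplyBy x) (multiplyBy x⁻¹) (undo x x⁻¹ xx⁻¹≡1) (undo x⁻¹ x (trans (*-comm x⁻¹ x) xx⁻¹≡1))
    where
    x⁻¹ = proj₁ (inverse x x≢0)
    xx⁻¹≡1 = proj₂ (inverse x x≢0)
    multiplyBy : F → Fin q → Fin q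
    multiplyBy u i = toIndex (u * fromIndex i)
    undo : ∀ u v → u * v ≡ 1# → ∀ i → multiplyBy u (multiplyBy v i) ≡ i
    undo u v uv≡1 i = begin
      toIndex (u * fromIndex (toIndex (v * fromIndex i)))  ≡⟨ cong (λ z → toIndex (u * z)) (fromIndex-toIndex _) ⟩
      toIndex (u * (v * fromIndex i))                      ≡⟨ cong toIndex (sym (*-assoc u v _)) ⟩
      toIndex (u * v * fromIndex i)                        ≡⟨ cong (λ z → toIndex (z * fromIndex i)) uv≡1 ⟩
      toIndex (1# * fromIndex i)                           ≡⟨ cong toIndex (*-identityˡ _) ⟩
      toIndex (fromIndex i)                                ≡⟨ toIndex-fromIndex i ⟩
      i                                                    ∎

  -- With 0 replaced by 1, the product P over F is non-zero; since scaling by x permutes F,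
  -- comparing P with the product of the scaled factors gives x^q P = x P.
  fermat : ∀ x → ¬ (x ≡ 0#) → x ^ q ≡ x
  fermat x x≢0 = *-cancelˡ (x ^ q) x (∏-nonzero g (λ i → unit≢0 (fromIndex i))) (begin
    P * x ^ q                ≡⟨ *-comm P _ ⟩
    x ^ q * P                ≡⟨ cong (_* P) (sym (∏-constant q x)) ⟩
    ∏ {q} (λ _ → x) * P      ≡⟨ sym (∏-distrib-* (λ _ → x) g) ⟩
    ∏ (λ i → x * g i)        ≡⟨ ∏-cong (λ i → trans (scale (fromIndex i)) (cong (λ z → h i * unit z) (sym (fromIndex-toIndex _)))) ⟩
    ∏ (λ i → h i * g (σ i))  ≡⟨ ∏-distrib-* h (λ i → g (σ i)) ⟩
    ∏ h * ∏ (λ i → g (σ i))  ≡⟨ cong₂ _*_ (trans (∏-single h (toIndex 0#) h≡1) h₀≡x) (sym (∏-permute g (scaling x x≢0))) ⟩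
    x * P                    ≡⟨ *-comm x P ⟩
    P * x                    ∎)
    where
    unit : F → F
    unit y = ifZero y 1# y
    unit≢0 : ∀ y → ¬ (unit y ≡ 0#)
    unit≢0 y with y ≟ 0#
    ... | yes _   = λ 1≡0 → 0≢1 (sym 1≡0)
    ... | no  y≢0 = y≢0
    g : Fin q → F
    g i = unit (fromIndex i)
    P = ∏ g
    h : Fin q → F
    h i = ifZero (fromIndex i) x 1#
    σ : Fin q → Fin q
    σ = scaling x x≢0 Perm.⟨$⟩ʳ_
    scale : ∀ y → x * unit y ≡ ifZero y x 1# * unit (x * y)
    scale y with y ≟ 0#
    ... | yes y≡0 = sym (cong (x *_) (ifZero-zero 1# (x * y) (trans (cong (x *_) y≡0) (zeroʳ x))))
    ... | no  y≢0 = sym (trans (*-identityˡ _) (ifZero-nonzero 1# (x * y) (x*y≢0 x≢0 y≢0)))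
    h≡1 : ∀ i → ¬ (i ≡ toIndex 0#) → h i ≡ 1#
    h≡1 i i≢0 = ifZero-nonzero x 1# (λ eq → i≢0 (trans (sym (toIndex-fromIndex i)) (cong toIndex eq)))
    h₀≡x : h (toIndex 0#) ≡ x
    h₀≡x = ifZero-zero x 1# (fromIndex-toIndex 0#)

  x^[q∸1]≡1 : ∀ x → ¬ (x ≡ 0#) → x ^ (q ∸ 1) ≡ 1#
  x^[q∸1]≡1 x x≢0 = *-cancelˡ (x ^ (q ∸ 1)) 1# x≢0 (begin
    x ^ suc (q ∸ 1)  ≡⟨ cong (x ^_) 1+[q∸1]≡q ⟩
    x ^ q            ≡⟨ fermat x x≢0 ⟩
    x                ≡⟨ sym (*-identityʳ x) ⟩
    x * 1#           ∎)

  S-power : ∀ {d e} → q ∸ 1 ≡ e ℕ.* d → ∀ {y} → InS d y → y ^ e ≡ 1#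
  S-power {d} {e} q∸1≡ed {y} (x , x≢0 , x^d≡y) = begin
    y ^ e          ≡⟨ cong (_^ e) (sym x^d≡y) ⟩
    (x ^ d) ^ e    ≡⟨ ^-assocʳ x d e ⟩
    x ^ (d ℕ.* e)  ≡⟨ cong (x ^_) (trans (ℕP.*-comm d e) (sym q∸1≡ed)) ⟩
    x ^ (q ∸ 1)    ≡⟨ x^[q∸1]≡1 x x≢0 ⟩
    1#             ∎

  characteristic-divides : ∀ {p} → Prime p → fromℕ p ≡ 0# → ∀ k → fromℕ k ≡ 0# → p ∣ k
  characteristic-divides {p} p-prime p≡0 k k≡0 = divides (r ℕP.≟ 0)
    where
    instance _ = prime⇒nonZero p-prime
    r = k % p
    multiple≡0 : ∀ {m} → fromℕ m ≡ 0# → ∀ t → fromℕ (t ℕ.* m) ≡ 0#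
    multiple≡0 m≡0 t = trans (fromℕ-homo-* t _) (trans (cong (fromℕ t *_) m≡0) (zeroʳ _))
    r≡0 : fromℕ r ≡ 0#
    r≡0 = begin
      fromℕ r                        ≡⟨ sym (+-identityʳ _) ⟩
      fromℕ r + 0#                   ≡⟨ cong (fromℕ r +_) (sym (multiple≡0 p≡0 (k / p))) ⟩
      fromℕ r + fromℕ (k / p ℕ.* p)  ≡⟨ sym (fromℕ-homo-+ r _) ⟩
      fromℕ (r ℕ.+ k / p ℕ.* p)      ≡⟨ cong fromℕ (sym (m≡m%n+[m/n]*n k p)) ⟩
      fromℕ k                        ≡⟨ k≡0 ⟩
      0#                             ∎
    1+A≢B : ∀ {A B} → fromℕ A ≡ 0# → fromℕ B ≡ 0# → ¬ (1 ℕ.+ A ≡ B)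
    1+A≢B {A} {B} A≡0 B≡0 eq = 0≢1 (sym (begin
      1#               ≡⟨ sym (+-identityʳ 1#) ⟩
      1# + 0#          ≡⟨ cong (1# +_) (sym A≡0) ⟩
      fromℕ (1 ℕ.+ A)  ≡⟨ cong fromℕ eq ⟩
      fromℕ B          ≡⟨ B≡0 ⟩
      0#               ∎))
    contradiction : Bézout.Identity 1 p r → ⊥
    contradiction (Bézout.+- x y eq) = 1+A≢B (multiple≡0 r≡0 y) (multiple≡0 p≡0 x) eq
    contradiction (Bézout.-+ x y eq) = 1+A≢B (multiple≡0 p≡0 x) (multiple≡0 r≡0 y) eq
    divides : Dec (r ≡ 0) → p ∣ k
    divides (yes r≡0) = m%n≡0⇒n∣m k p r≡0
    divides (no  r≢0) = ⊥-elim (contradiction (coprime-Bézout (prime⇒coprime p-prime {{ℕ.≢-nonZero r≢0}} (m%n<n k p))))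

  -- Counting

  count : {P : F → Set} → Decidable P → List F → ℕ
  count P? xs = List.length (List.filter P? xs)

  count-cong : {P Q : F → Set} (P? : Decidable P) (Q? : Decidable Q) {xs : List F} →
    All (λ y → (P y → Q y) × (Q y → P y)) xs → count P? xs ≡ count Q? xs
  count-cong P? Q? [] = refl
  count-cong P? Q? {x ∷ xs} ((P⇒Q , Q⇒P) ∷ P⇔Q) with P? x
  ... | yes Px = trans (cong suc (count-cong P? Q? P⇔Q)) (cong List.length (sym (List.filter-accept Q? (P⇒Q Px))))
  ... | no ¬Px = trans (count-cong P? Q? P⇔Q) (cong List.length (sym (List.filter-reject Q? (λ Qx → ¬Px (Q⇒P Qx)))))

  count-insert : {P Q : F → Set} (P? : Decidable P) (Q? : Decidable Q) {y₀ : F} →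
    Q ≐ (λ y → y ≡ y₀ ⊎ P y) → ¬ P y₀ → ∀ {xs} → Unique xs → y₀ ∈ xs → count Q? xs ≡ suc (count P? xs)
  count-insert {P} {Q} P? Q? {y₀} Q≐ ¬Py₀ {x ∷ xs} (x∉xs ∷ _) (here refl) = begin
    count Q? (x ∷ xs)
      ≡⟨ cong List.length (List.filter-accept Q? (proj₂ Q≐ (inj₁ refl))) ⟩
    suc (count Q? xs)
      ≡⟨ cong suc (count-cong Q? P? (All.map (λ y≢x → (Q⇒P y≢x , λ Py → proj₂ Q≐ (inj₂ Py))) x∉xs)) ⟩
    suc (count P? xs)
      ≡⟨ cong suc (cong List.length (sym (List.filter-reject P? ¬Py₀))) ⟩
    suc (count P? (x ∷ xs)) ∎
    where
    Q⇒P : ∀ {y} → ¬ (x ≡ y) → Q y → P y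
    Q⇒P x≢y Qy with proj₁ Q≐ Qy
    ... | inj₁ y≡x = ⊥-elim (x≢y (sym y≡x))
    ... | inj₂ Py  = Py
  count-insert P? Q? {y₀} Q≐ ¬Py₀ {x ∷ xs} (x∉xs ∷ unique) (there y₀∈xs) with P? x
  ... | yes Px = trans (cong List.length (List.filter-accept Q? (proj₂ Q≐ (inj₂ Px))))
                       (cong suc (count-insert P? Q? Q≐ ¬Py₀ unique y₀∈xs))
  ... | no ¬Px = trans (cong List.length (List.filter-reject Q? ([ All.lookup x∉xs y₀∈xs , ¬Px ]′ ∘ proj₁ Q≐)))
                       (count-insert P? Q? Q≐ ¬Py₀ unique y₀∈xs)

  length-filter-split : {P : F → Set} (P? : Decidable P) (xs : List F) →
    List.length xs ≡ count P? xs ℕ.+ count (λ y → ¬? (P? y)) xs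
  length-filter-split P? [] = refl
  length-filter-split P? (x ∷ xs) with P? x
  ... | yes _ = cong suc (length-filter-split P? xs)
  ... | no  _ = trans (cong suc (length-filter-split P? xs)) (sym (ℕP.+-suc _ _))

  count-filter-≤ : {P Q : F → Set} (P? : Decidable P) (Q? : Decidable Q) (xs : List F) →
    count P? (List.filter Q? xs) ≤ count P? xs
  count-filter-≤ P? Q? xs = Sublist.length-mono-≤ (Sublist.filter⁺ P? P? (λ { refl Pa → Pa }) (Sublist.filter-⊆ Q? xs))

  fibre-bound : (f : F → F) (d : ℕ) (ys xs : List F) → All (λ x → f x ∈ ys) xs →
    (∀ y → count (λ x → f x ≟ y) xs ≤ d) → List.length xs ≤ d ℕ.* List.length ys
  fibre-bound f d []       []       _          _     = z≤n
  fibre-bound f d []       (x ∷ xs) (() ∷ _)   _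
  fibre-bound f d (y ∷ ys) xs       fxs∈y∷ys fibres =
    subst₂ _≤_ (sym (length-filter-split (λ x → f x ≟ y) xs)) (sym (ℕP.*-suc d _)) (ℕP.+-mono-≤ (fibres y) rest-bound)
    where
    rest = List.filter (λ x → ¬? (f x ≟ y)) xs
    frest∈ys : All (λ x → f x ∈ ys) rest
    frest∈ys = All.zipWith (λ { (here fx≡y , fx≢y) → ⊥-elim (fx≢y fx≡y) ; (there fx∈ys , _) → fx∈ys })
      (All.filter⁺ (λ x → ¬? (f x ≟ y)) fxs∈y∷ys , All.all-filter (λ x → ¬? (f x ≟ y)) xs)
    rest-bound : List.length rest ≤ d ℕ.* List.length ys
    rest-bound = fibre-bound f d ys rest frest∈ys
      (λ y′ → ℕP.≤-trans (count-filter-≤ (λ x → f x ≟ y′) (λ x → ¬? (f x ≟ y)) xs) (fibres y′))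

  elements-complete : ∀ y → y ∈ elements
  elements-complete y = subst (_∈ elements) (fromIndex-toIndex y) (∈-map⁺ fromIndex (∈-allFin (toIndex y)))

  elements-unique : Unique elements
  elements-unique = Unique.map⁺ fromIndex-injective (Unique.allFin⁺ q)
    where
    fromIndex-injective : ∀ {i j} → fromIndex i ≡ fromIndex j → i ≡ j
    fromIndex-injective {i} {j} eq = trans (sym (toIndex-fromIndex i)) (trans (cong toIndex eq) (toIndex-fromIndex j))

  length-elements : List.length elements ≡ q
  length-elements = trans (List.length-map fromIndex (List.allFin q)) (List.length-tabulate (λ i → i))

  monomial : ℕ → ℕ → F
  monomial d j with j ℕP.≟ d
  ... | yes _ = 1#
  ... | no  _ = 0#

  monomial-diagonal : ∀ d → monomial d d ≡ 1#
  monomial-diagonal d with d ℕP.≟ d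
  ... | yes _   = refl
  ... | no  d≢d = ⊥-elim (d≢d refl)

  monomial-offDiagonal : ∀ {d j} → ¬ (j ≡ d) → monomial d j ≡ 0#
  monomial-offDiagonal {d} {j} j≢d with j ℕP.≟ d
  ... | yes j≡d = ⊥-elim (j≢d j≡d)
  ... | no  _   = refl

  hasse-monomial : ∀ d x → hasse (suc d) (monomial d) x 0 ≡ x ^ d
  hasse-monomial d x = begin
    hasse (suc d) (monomial d) x 0
      ≡⟨ ∑<-single (suc d) d (λ j → monomial d j * (fromℕ (j C 0) * x ^ j)) (ℕP.n<1+n d)
                   (λ j _ j≢d → trans (cong (_* _) (monomial-offDiagonal j≢d)) (zeroˡ _)) ⟩
    monomial d d * (fromℕ 1 * x ^ d)
      ≡⟨ cong₂ (λ u v → u * (v * x ^ d)) (monomial-diagonal d) fromℕ-1 ⟩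
    1# * (1# * x ^ d)
      ≡⟨ trans (*-identityˡ _) (*-identityˡ _) ⟩
    x ^ d ∎

  root-count : ∀ d → ¬ (d ≡ 0) → ∀ y → count (λ x → (x ^ d) ≟ y) elements ≤ d
  root-count d d≢0 y with count (λ x → (x ^ d) ≟ y) elements ℕP.≤? d
  ... | yes few  = few
  ... | no  many = ⊥-elim (0≢1 (trans (sym (coefficients-vanish-uniform (suc d) xᵈ-y 1 roots
          (Unique.filter⁺ (λ x → (x ^ d) ≟ y) elements-unique)
          (All.map root-vanishes (All.all-filter (λ x → (x ^ d) ≟ y) elements))
          (subst (suc d ≤_) (sym (ℕP.*-identityʳ _)) (ℕP.≰⇒> many)) d (ℕP.n<1+n d))) xᵈ-y[d]≡1))
    where
    xᵈ-y : ℕ → F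
    xᵈ-y j = monomial d j + - constant y j
    roots = List.filter (λ x → (x ^ d) ≟ y) elements
    root-vanishes : ∀ {x} → x ^ d ≡ y → VanishesTo (suc d) xᵈ-y (x , 1)
    root-vanishes {x} x^d≡y zero _ = begin
      hasse (suc d) xᵈ-y x 0
        ≡⟨ hasse-sub (suc d) (monomial d) (constant y) x 0 ⟩
      hasse (suc d) (monomial d) x 0 + - hasse (suc d) (constant y) x 0
        ≡⟨ cong₂ (λ u v → u + - v) (hasse-monomial d x) (hasse-constant d y x 0) ⟩
      x ^ d + - y
        ≡⟨ cong (_+ - y) x^d≡y ⟩
      y + - y
        ≡⟨ -‿inverseʳ y ⟩
      0# ∎
    root-vanishes _ (suc k) (s≤s ())
    xᵈ-y[d]≡1 : xᵈ-y d ≡ 1#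
    xᵈ-y[d]≡1 = begin
      monomial d d + - constant y d  ≡⟨ cong₂ (λ u v → u + - v) (monomial-diagonal d) (constant-suc y d≢0) ⟩
      1# + - 0#                      ≡⟨ cong (1# +_) (trans (sym (+-identityˡ (- 0#))) (-‿inverseʳ 0#)) ⟩
      1# + 0#                        ≡⟨ +-identityʳ 1# ⟩
      1#                             ∎

  cofactor≢0 : ∀ {d e} → q ∸ 1 ≡ e ℕ.* d → ¬ (e ≡ 0)
  cofactor≢0 q∸1≡ed refl = ℕP.<⇒≢ (ℕP.∸-monoˡ-< 2≤q (s≤s z≤n)) (sym q∸1≡ed)

  -- x ↦ x^d maps F into {0} ∪ S_d with fibres of size at most d, so q ≤ d (|S_d| + 1).
  cofactor≤cardS : ∀ d e → 1 < d → q ∸ 1 ≡ e ℕ.* d → e ≤ cardS d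
  cofactor≤cardS d e 1<d q∸1≡ed = ℕP.≤-pred (ℕP.*-cancelʳ-< d e (suc (cardS d))
    (subst₂ _<_ q∸1≡ed (ℕP.*-comm d _) (ℕP.<-≤-trans (subst (q ∸ 1 <_) 1+[q∸1]≡q ℕP.≤-refl) q≤d[1+s])))
    where
    d≢0 : ¬ (d ≡ 0)
    d≢0 d≡0 = ℕP.<⇒≢ (ℕP.<-trans (s≤s z≤n) 1<d) (sym d≡0)
    image : ∀ x → x ^ d ∈ (0# ∷ List.filter (InS? d) elements)
    image x with x ≟ 0#
    ... | yes x≡0 = here (trans (cong (_^ d) x≡0) (trans (cong (0# ^_) (sym (ℕP.suc-pred d {{ℕ.≢-nonZero d≢0}}))) (zeroˡ _)))
    ... | no  x≢0 = there (∈-filter⁺ (InS? d) (elements-complete (x ^ d)) (x , x≢0 , refl))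
    q≤d[1+s] : q ≤ d ℕ.* suc (cardS d)
    q≤d[1+s] = subst (_≤ d ℕ.* suc (cardS d)) length-elements
      (fibre-bound (_^ d) d (0# ∷ List.filter (InS? d) elements) elements (All.tabulate (λ {x} _ → image x)) (root-count d d≢0))

  module Image {I : Set} (ψ : I → F) where

    InImage : List I → F → Set
    InImage zs y = Any (λ z → ψ z ≡ y) zs

    InImage? : ∀ zs → Decidable (InImage zs)
    InImage? zs y = Any.any? (λ z → ψ z ≟ y) zs

    #image : List I → ℕ
    #image zs = count (InImage? zs) elements

    #image-old : ∀ z zs → InImage zs (ψ z) → #image (z ∷ zs) ≡ #image zs
    #image-old z zs ψz∈ = cong List.length (List.filter-≐ (InImage? (z ∷ zs)) (InImage? zs)
      ((λ { (here ψz≡y) → subst (InImage zs) ψz≡y ψz∈ ; (there y∈) → y∈ }) , there) elements)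

    #image-new : ∀ z zs → ¬ InImage zs (ψ z) → #image (z ∷ zs) ≡ suc (#image zs)
    #image-new z zs ψz∉ = count-insert (InImage? zs) (InImage? (z ∷ zs))
      ((λ { (here ψz≡y) → inj₁ (sym ψz≡y) ; (there y∈) → inj₂ y∈ }) , [ (λ y≡ψz → here (sym y≡ψz)) , there ]′)
      ψz∉ elements-unique (elements-complete (ψ z))

    #image≤length : ∀ zs → #image zs ≤ List.length zs
    #image≤length []       = ℕP.≤-reflexive (cong List.length (List.filter-none (InImage? []) (All.universal (λ _ ()) elements)))
    #image≤length (z ∷ zs) with InImage? zs (ψ z)
    ... | yes ψz∈ = subst (_≤ suc (List.length zs)) (sym (#image-old z zs ψz∈)) (ℕP.m≤n⇒m≤1+n (#image≤length zs))
    ... | no  ψz∉ = subst (_≤ suc (List.length zs)) (sym (#image-new z zs ψz∉)) (s≤s (#image≤length zs))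

    #image≡length⇒distinct : ∀ zs → #image zs ≡ List.length zs → AllPairs (λ u v → ¬ (ψ u ≡ ψ v)) zs
    #image≡length⇒distinct []       _ = []
    #image≡length⇒distinct (z ∷ zs) #≡ with InImage? zs (ψ z)
    ... | yes ψz∈ = ⊥-elim (ℕP.<-irrefl refl (subst (_≤ List.length zs) (trans (sym (#image-old z zs ψz∈)) #≡)
                                                    (#image≤length zs)))
    ... | no  ψz∉ = All.map (λ ψz≢ψv ψz≡ψv → ψz≢ψv (sym ψz≡ψv)) (All.¬Any⇒All¬ zs ψz∉)
                  ∷ #image≡length⇒distinct zs (ℕP.suc-injective (trans (sym (#image-new z zs ψz∉)) #≡))

  module Sumset {d n m : ℕ} (a : Fin n → F) (b : Fin m → F)
    (A+B≡S : ∀ y → InS d y ⇔ ∃₂ λ i k → a i + b k ≡ y) where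

    ψ : Fin n × Fin m → F
    ψ ik = a (proj₁ ik) + b (proj₂ ik)

    pairs : List (Fin n × Fin m)
    pairs = List.cartesianProduct (List.allFin n) (List.allFin m)

    pairs-complete : ∀ ik → ik ∈ pairs
    pairs-complete (i , k) = ∈-cartesianProduct⁺ (∈-allFin i) (∈-allFin k)

    open Image ψ

    cardS≡#image : cardS d ≡ #image pairs
    cardS≡#image = cong List.length (List.filter-≐ (InS? d) (InImage? pairs) (to , from) elements)
      where
      to : ∀ {y} → InS d y → InImage pairs y
      to {y} y∈S with Equivalence.to (A+B≡S y) y∈S
      ... | i , k , ψik≡y = Any.map (λ { refl → ψik≡y }) (pairs-complete (i , k))
      from : ∀ {y} → InImage pairs y → InS d y
      from {y} y∈image with Any.satisfied y∈image
      ... | (i , k) , ψik≡y = Equivalence.from (A+B≡S y) (i , k , ψik≡y)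

    length-pairs : List.length pairs ≡ n ℕ.* m
    length-pairs = trans (length-cartesianProduct (List.allFin n) (List.allFin m))
      (cong₂ ℕ._*_ (List.length-tabulate {n = n} (λ i → i)) (List.length-tabulate {n = m} (λ k → k)))

    cardS≤nm : cardS d ≤ n ℕ.* m
    cardS≤nm = subst₂ _≤_ (sym cardS≡#image) length-pairs (#image≤length pairs)

    cardS≡nm⇒injective : cardS d ≡ n ℕ.* m → Injective _≡_ _≡_ ψ
    cardS≡nm⇒injective |S|≡nm = AllPairs-injective ψ (×-≡-dec Fin._≟_ Fin._≟_) pairs-complete
      (#image≡length⇒distinct pairs (trans (sym cardS≡#image) (trans |S|≡nm (sym length-pairs))))

    sums-in-μₑ : ∀ e → q ∸ 1 ≡ e ℕ.* d → ∀ i k → (a i + b k) ^ e ≡ 1#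
    sums-in-μₑ e q∸1≡ed i k = S-power {d} {e} q∸1≡ed (Equivalence.from (A+B≡S (a i + b k)) (i , k , refl))

  stepanov-moments : ∀ {n′ m e} (a : Fin (suc n′) → F) (b : Fin m → F) → Injective _≡_ _≡_ b →
    (∀ i k → (a i + b k) ^ e ≡ 1#) → e < m ℕ.* suc n′ → ∀ c →
    (∀ j → j < n′ → sum (λ i → c i * a i ^ j) ≡ 0#) → sum (λ i → c i * a i ^ n′) ≡ 1# →
    (∀ j → j < n′ ℕ.+ e → fromℕ ((n′ ℕ.+ e) C j) * sum (λ i → c i * a i ^ j) ≡ 0#)
    × sum (λ i → c i * a i ^ (n′ ℕ.+ e)) ≡ 1#
  stepanov-moments a b b-injective sums-in-μₑ e<mn c c-low c-top = S.low-moment , S.top-moment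
    where module S = Stepanov a c b c-low c-top b-injective sums-in-μₑ e<mn

  stepanov-divisibility : ∀ {p n′ m e} → Prime p → fromℕ p ≡ 0# → ¬ (e ≡ 0) →
    (a : Fin (suc n′) → F) → Injective _≡_ _≡_ a → (b : Fin m → F) → Injective _≡_ _≡_ b →
    (∀ i k → (a i + b k) ^ e ≡ 1#) → e < m ℕ.* suc n′ → p ∣ (n′ ℕ.+ e) C e
  stepanov-divisibility {n′ = n′} p-prime p≡0 e≢0 a a-injective b b-injective sums-in-μₑ e<mn =
    characteristic-divides p-prime p≡0 _ (S.C[N,e]≡0 e≢0)
    where
    c = dualVandermonde n′ a a-injective
    module S = Stepanov a (proj₁ c) b (proj₁ (proj₂ c)) (proj₂ (proj₂ c)) b-injective sums-in-μₑ e<mn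

proposition3p4 :
    ∀ {q p d : ℕ} (𝔽 : FiniteField q) → let open FiniteField 𝔽 in
    Prime p → (∃ λ k → q ≡ p ℕ.^ k) → fromℕ p ≡ 0# →
    (d∣q-1 : d ∣ q ∸ 1) → 1 < d →
    ∀ {n m : ℕ} (a : Fin n → F) (b : Fin m → F) →
    Injective _≡_ _≡_ a → Injective _≡_ _≡_ b → 2 ≤ n → 2 ≤ m →
    (∀ y → InS d y ⇔ ∃₂ λ i k → a i + b k ≡ y) →
    let e = quotient d∣q-1
        s = cardS d
    in (n ℕ.* m ≡ s × ¬ (s < n ℕ.* m)
          × Injective _≡_ _≡_ (λ (ik : Fin n × Fin m) → a (proj₁ ik) + b (proj₂ ik)))
       ⊎ (s < n ℕ.* m × ¬ (n ℕ.* m ≡ s)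
          × p ∣ ((n ∸ 1 ℕ.+ e) C e) × p ∣ ((m ∸ 1 ℕ.+ e) C e)
          × (∀ (c : Fin n → F) →
               (∀ j → j < n ∸ 1 → sum (λ i → c i * a i ^ j) ≡ 0#) →
               sum (λ i → c i * a i ^ (n ∸ 1)) ≡ 1# →
               (∀ j → j < n ∸ 1 ℕ.+ e → fromℕ ((n ∸ 1 ℕ.+ e) C j) * sum (λ i → c i * a i ^ j) ≡ 0#)
               × sum (λ i → c i * a i ^ (n ∸ 1 ℕ.+ e)) ≡ 1#)
          × (∀ (dd : Fin m → F) →
               (∀ l → l < m ∸ 1 → sum (λ k → dd k * b k ^ l) ≡ 0#) →
               sum (λ k → dd k * b k ^ (m ∸ 1)) ≡ 1# →
               (∀ l → l < m ∸ 1 ℕ.+ e → fromℕ ((m ∸ 1 ℕ.+ e) C l) * sum (λ k → dd k * b k ^ l) ≡ 0#)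
               × sum (λ k → dd k * b k ^ (m ∸ 1 ℕ.+ e)) ≡ 1#))
proposition3p4 _ _ _ _ _ _ {zero}  _ _ _ _ () _ _
proposition3p4 _ _ _ _ _ _ {suc _} {zero} _ _ _ _ _ () _
proposition3p4 {q} {d = d} 𝔽 p-prime _ p≡0 d∣q-1 1<d {suc n′} {suc m′} a b a-injective b-injective _ _ A+B≡S
  with FiniteField.cardS 𝔽 d ℕP.≟ suc n′ ℕ.* suc m′
... | yes |S|≡nm =
  inj₁ (sym |S|≡nm , ℕP.<-irrefl |S|≡nm , FieldProperties.Sumset.cardS≡nm⇒injective 𝔽 a b A+B≡S |S|≡nm)
... | no  |S|≢nm = inj₂ (|S|<nm , (λ nm≡|S| → |S|≢nm (sym nm≡|S|))
    , stepanov-divisibility p-prime p≡0 e≢0 a a-injective b b-injective a+b∈μₑ e<mn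
    , stepanov-divisibility p-prime p≡0 e≢0 b b-injective a a-injective b+a∈μₑ e<nm
    , stepanov-moments a b b-injective a+b∈μₑ e<mn
    , stepanov-moments b a a-injective b+a∈μₑ e<nm)
  where
  open FiniteField 𝔽
  open FieldProperties 𝔽
  open Sumset {d = d} a b A+B≡S
  e = quotient d∣q-1
  q∸1≡ed : q ∸ 1 ≡ e ℕ.* d
  q∸1≡ed = _∣_.equality d∣q-1
  e≢0 : ¬ (e ≡ 0)
  e≢0 = cofactor≢0 q∸1≡ed
  |S|<nm : cardS d < suc n′ ℕ.* suc m′
  |S|<nm = ℕP.≤∧≢⇒< cardS≤nm |S|≢nm
  e<nm : e < suc n′ ℕ.* suc m′
  e<nm = ℕP.≤-<-trans (cofactor≤cardS d e 1<d q∸1≡ed) |S|<nm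
  e<mn : e < suc m′ ℕ.* suc n′
  e<mn = subst (e <_) (ℕP.*-comm (suc n′) (suc m′)) e<nm
  a+b∈μₑ : ∀ i k → (a i + b k) ^ e ≡ 1#
  a+b∈μₑ = sums-in-μₑ e q∸1≡ed
  b+a∈μₑ : ∀ k i → (b k + a i) ^ e ≡ 1#
  b+a∈μₑ k i = trans (cong (_^ e) (+-comm (b k) (a i))) (a+b∈μₑ i k)
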